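{- For $n\geq 1$, the number $t_n(132)$ of permutations $\pi\in\mathcal{S}_n$ such that both $\pi$ and $\theta(\pi)$ avoid $132$ equals $\sum_{k=0}^{n+1} F_{n+1-k}F_k$, where $F_m$ is the $m$-th Fibonacci number. Equivalently, $\sum_{n\ge 1} t_n(132)x^n = \dfrac{x}{(1-x-x^2)^2}$.
   Context: $\mathcal{S}_n$ is the symmetric group on $[n]$, permutations in one-line notation $\pi_1\cdots\pi_n$. A permutation avoids a pattern $\tau$ if it has no subsequence order-isomorphic to $\tau$. The standard cycle notation of $\pi$ writes each cycle (fixed points included) with its largest element first and orders cycles by increasing largest element. The fundamental bijection $\theta:\mathcal{S}_n\to\mathcal{S}_n$ maps $\pi$ to the permutation whose one-line notation is obtained by erasing the parentheses of the standard cycle notation of $\pi$. Fibonacci numbers: $F_0=0$, $F_1=F_2=1$, $F_{m}=F_{m-1}+F_{m-2}$. -}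

module Defs where

open import Data.Nat using (ℕ; zero; suc; _+_; _*_; _∸_; _<_; _≤ᵇ_; _≡ᵇ_)
open import Data.Bool using (Bool; true; false; if_then_else_)
open import Data.List using (List; []; _∷_; length; map; upTo; concatMap; lookup)
open import Data.Nat.ListAction using (sum)
open import Data.Bool.ListAction using (all)
open import Data.Fin using (Fin; toℕ)
import Data.Fin as Fin
open import Data.Product using (∃; _×_; _,_)
open import Relation.Nullary using (¬_)

fib : ℕ → ℕ
fib zero = zero
fib (suc zero) = suc zero
fib (suc (suc m)) = fib (suc m) + fib m

-- A permutation of [n] in one-line notation is a list of naturals
-- π₁ ⋯ πₙ that is a rearrangement of 1, 2, …, n (see IsPerm in Statement).
oneToN : ℕ → List ℕ
oneToN n = map suc (upTo n)

-- π(i) for 1-based i (value 0 if out of range; never used for permutations)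
app : List ℕ → ℕ → ℕ
app [] _ = zero
app (x ∷ xs) zero = zero
app (x ∷ xs) (suc zero) = x
app (x ∷ xs) (suc (suc i)) = app xs (suc i)

-- the cycle of π through m, written starting at m: m, π(m), π²(m), …
-- (fuel = length π suffices, as a cycle has at most n elements)
cycleFrom : List ℕ → ℕ → List ℕ
cycleFrom π m = m ∷ go (app π m) (length π)
  where
  go : ℕ → ℕ → List ℕ
  go x zero = []
  go x (suc f) = if x ≡ᵇ m then [] else x ∷ go (app π x) f

isCycleMax : List ℕ → ℕ → Bool
isCycleMax π m = all (λ x → x ≤ᵇ m) (cycleFrom π m)

-- The fundamental bijection θ: write the standard cycle notation (each
-- cycle starting with its largest element, cycles ordered by increasing
-- largest element) and erase the parentheses.
θ : List ℕ → List ℕ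
θ π = concatMap (λ m → if isCycleMax π m then cycleFrom π m else [])
                (oneToN (length π))

Contains132 : List ℕ → Set
Contains132 π =
  ∃ λ (i : Fin (length π)) → ∃ λ (j : Fin (length π)) → ∃ λ (k : Fin (length π)) →
    (i Fin.< j) × (j Fin.< k) ×
    (lookup π i < lookup π k) × (lookup π k < lookup π j)

Avoids132 : List ℕ → Set
Avoids132 π = ¬ Contains132 π

fibConv : ℕ → ℕ
fibConv n = sum (map (λ k → fib (suc n ∸ k) * fib k) (upTo (suc (suc n))))

module Submission where

open import Defs
open import Data.Nat using (ℕ; _≥_)
open import Data.List using (List; length)
open import Data.List.Membership.Propositional using (_∈_)
open import Data.List.Relation.Unary.Unique.Propositional using (Unique)
open import Data.List.Relation.Binary.Permutation.Propositional using (_↭_)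
open import Data.Product using (Σ; _×_)
open import Function.Bundles using (_⇔_)
open import Relation.Binary.PropositionalEquality using (_≡_)

open import Data.Nat
open import Data.Nat.Properties
open import Data.Nat.ListAction using (sum)
open import Data.Nat.ListAction.Properties using (sum-++)
open import Algebra.Properties.CommutativeSemigroup +-commutativeSemigroup using (interchange)
open import Data.Bool using (true; false; if_then_else_; T)
open import Data.Bool.ListAction using (all; and)
open import Data.Empty using (⊥; ⊥-elim)
open import Data.Unit using (tt)
open import Data.Fin using (Fin; toℕ; fromℕ<) renaming (zero to fzero; suc to fsuc)
import Data.Fin as Fin
import Data.Fin.Properties as Fin
open import Data.Product using (∃; ∃₂; _,_; proj₁; proj₂)
open import Data.Sum using (_⊎_; inj₁; inj₂)
open import Data.List using ([]; _∷_; map; _++_; [_]; concat; concatMap; lookup; applyUpTo; upTo)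
import Data.List.Properties as List
open import Data.List.Membership.Propositional using (find; lose)
open import Data.List.Membership.Propositional.Properties
  using (∈-map⁺; ∈-map⁻; ∈-++⁺ˡ; ∈-++⁺ʳ; ∈-++⁻; ∈-concatMap⁺; ∈-concatMap⁻; ∈-upTo⁻)
import Data.List.Membership.DecPropositional _≟_ as Dec
open import Data.List.Relation.Unary.Any using (here; there)
open import Data.List.Relation.Unary.All using (All)
import Data.List.Relation.Unary.All as All
open import Data.List.Relation.Unary.All.Properties using (all⁺; all⁻)
open import Data.List.Relation.Unary.AllPairs using (AllPairs)
import Data.List.Relation.Unary.AllPairs as AllPairs
import Data.List.Relation.Unary.Unique.Propositional.Properties as Unique
open import Data.List.Relation.Binary.Disjoint.Propositional using (Disjoint)
open import Data.List.Relation.Binary.Permutation.Propositional using (prep; swap; ↭-refl; ↭-reflexive; ↭-sym; ↭-trans; ↭⇒↭ₛ)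
open import Data.List.Relation.Binary.Permutation.Propositional.Properties
  using (∈-resp-↭; ↭-length; shift; drop-mid; drop-∷; ∷↭∷ʳ; ↭-map-inv; ↭-singleton-inv)
  renaming (++⁺ʳ to ↭-++⁺ʳ; map⁺ to ↭-map⁺)
open import Data.List.Relation.Binary.Sublist.Propositional {A = ℕ}
  using (_⊆_; _∷ʳ_; ⊆-refl; ⊆-trans; minimum; from∈; to∈)
open import Data.List.Relation.Binary.Sublist.Propositional.Properties using (All-resp-⊆; ∷ˡ⁻; map⁺; ++⁺; ++⁺ʳ)
open import Function using (_∘_; _∘′_)
open import Function.Bundles using (mk⇔)
open import Relation.Nullary using (¬_; Dec; yes; no; _×-dec_)
open import Relation.Binary.Definitions using (tri<; tri≈; tri>)
open import Relation.Binary.PropositionalEquality hiding ([_])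
open import Data.List.Relation.Binary.Permutation.Setoid.Properties (setoid ℕ) using (Unique-resp-↭)

range : ℕ → ℕ → List ℕ
range a zero    = []
range a (suc k) = a ∷ range (suc a) k

applyUpTo-range : ∀ (f : ℕ → ℕ) a k → (∀ i → f i ≡ a + i) → applyUpTo f k ≡ range a k
applyUpTo-range f a zero    f≗ = refl
applyUpTo-range f a (suc k) f≗ = cong₂ _∷_ (trans (f≗ 0) (+-identityʳ a))
  (applyUpTo-range (f ∘′ suc) (suc a) k (λ i → trans (f≗ (suc i)) (+-suc a i)))

oneToN≡range : ∀ n → oneToN n ≡ range 1 n
oneToN≡range n = trans (List.map-upTo suc n) (applyUpTo-range suc 1 n (λ _ → refl))

length-range : ∀ a k → length (range a k) ≡ k
length-range a zero    = refl
length-range a (suc k) = cong suc (length-range (suc a) k)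

range-suc : ∀ a k → range (suc a) k ≡ map suc (range a k)
range-suc a zero    = refl
range-suc a (suc k) = cong (suc a ∷_) (range-suc (suc a) k)

range-∷ʳ : ∀ a k → range a (suc k) ≡ range a k ++ [ a + k ]
range-∷ʳ a zero    = cong [_] (sym (+-identityʳ a))
range-∷ʳ a (suc k) = cong (a ∷_) (trans (range-∷ʳ (suc a) k) (cong (λ z → range (suc a) k ++ [ z ]) (sym (+-suc a k))))

∈-range⁻ : ∀ {a k x} → x ∈ range a k → a ≤ x × x < a + k
∈-range⁻ {a} {suc k} (here refl) = ≤-refl , subst (a <_) (sym (+-suc a k)) (s≤s (m≤m+n a k))
∈-range⁻ {a} {suc k} {x} (there x∈) with l , u ← ∈-range⁻ x∈ = <⇒≤ l , subst (x <_) (sym (+-suc a k)) u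

∈-range⁺ : ∀ {a k x} → a ≤ x → x < a + k → x ∈ range a k
∈-range⁺ {a} {zero}  a≤x x<a+0 = ⊥-elim (<-irrefl refl (≤-trans x<a+0 (subst (_≤ _) (sym (+-identityʳ a)) a≤x)))
∈-range⁺ {a} {suc k} {x} a≤x x<a+k with a ≟ x
... | yes refl = here refl
... | no a≢x   = there (∈-range⁺ (≤∧≢⇒< a≤x a≢x) (subst (x <_) (+-suc a k) x<a+k))

_∈[1‥_] : ℕ → ℕ → Set
x ∈[1‥ n ] = 1 ≤ x × x ≤ n

∈-range1⁻ : ∀ {n x} → x ∈ range 1 n → x ∈[1‥ n ]
∈-range1⁻ x∈ with l , u ← ∈-range⁻ x∈ = l , ≤-pred u

∈-range1⁺ : ∀ {n x} → x ∈[1‥ n ] → x ∈ range 1 n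
∈-range1⁺ (l , u) = ∈-range⁺ l (s≤s u)


Has132 : List ℕ → Set
Has132 π = Σ ℕ λ a → Σ ℕ λ b → Σ ℕ λ c → (a ∷ b ∷ c ∷ []) ⊆ π × a < c × c < b

No132 : List ℕ → Set
No132 π = ¬ Has132 π


module _ where

  open import Data.List.Relation.Unary.All using ([]; _∷_)
  open import Data.List.Relation.Unary.AllPairs using ([]; _∷_)
  open import Data.List.Relation.Binary.Sublist.Propositional {A = ℕ} using ([]; _∷_)

  range-increasing : ∀ a k → AllPairs _<_ (range a k)
  range-increasing a zero    = []
  range-increasing a (suc k) = All.tabulate (proj₁ ∘′ ∈-range⁻) ∷ range-increasing (suc a) k

  range-unique : ∀ a k → Unique (range a k)
  range-unique a k = AllPairs.map <⇒≢ (range-increasing a k)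


  lookup-⊆₁ : ∀ (π : List ℕ) k → [ lookup π k ] ⊆ π
  lookup-⊆₁ (x ∷ π) fzero    = refl ∷ minimum π
  lookup-⊆₁ (x ∷ π) (fsuc k) = x ∷ʳ lookup-⊆₁ π k

  lookup-⊆₂ : ∀ (π : List ℕ) j k → j Fin.< k → (lookup π j ∷ lookup π k ∷ []) ⊆ π
  lookup-⊆₂ (x ∷ π) fzero    (fsuc k) _   = refl ∷ lookup-⊆₁ π k
  lookup-⊆₂ (x ∷ π) (fsuc j) (fsuc k) j<k = x ∷ʳ lookup-⊆₂ π j k (≤-pred j<k)

  lookup-⊆₃ : ∀ (π : List ℕ) i j k → i Fin.< j → j Fin.< k →
              (lookup π i ∷ lookup π j ∷ lookup π k ∷ []) ⊆ π
  lookup-⊆₃ (x ∷ π) fzero    (fsuc j) (fsuc k) _   j<k = refl ∷ lookup-⊆₂ π j k (≤-pred j<k)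
  lookup-⊆₃ (x ∷ π) (fsuc i) (fsuc j) (fsuc k) i<j j<k = x ∷ʳ lookup-⊆₃ π i j k (≤-pred i<j) (≤-pred j<k)

  ⊆⇒lookup₁ : ∀ {c π} → [ c ] ⊆ π → Σ (Fin (length π)) λ k → lookup π k ≡ c
  ⊆⇒lookup₁ (refl ∷ _) = fzero , refl
  ⊆⇒lookup₁ (_ ∷ʳ τ) with k , eq ← ⊆⇒lookup₁ τ = fsuc k , eq

  ⊆⇒lookup₂ : ∀ {b c π} → (b ∷ c ∷ []) ⊆ π →
              Σ (Fin (length π)) λ j → Σ (Fin (length π)) λ k → j Fin.< k × lookup π j ≡ b × lookup π k ≡ c
  ⊆⇒lookup₂ (refl ∷ τ) with k , eq ← ⊆⇒lookup₁ τ = fzero , fsuc k , s≤s z≤n , refl , eq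
  ⊆⇒lookup₂ (_ ∷ʳ τ) with j , k , j<k , eq₁ , eq₂ ← ⊆⇒lookup₂ τ = fsuc j , fsuc k , s≤s j<k , eq₁ , eq₂

  ⊆⇒lookup₃ : ∀ {a b c π} → (a ∷ b ∷ c ∷ []) ⊆ π →
              Σ (Fin (length π)) λ i → Σ (Fin (length π)) λ j → Σ (Fin (length π)) λ k →
                i Fin.< j × j Fin.< k × lookup π i ≡ a × lookup π j ≡ b × lookup π k ≡ c
  ⊆⇒lookup₃ (refl ∷ τ) with j , k , j<k , eq₁ , eq₂ ← ⊆⇒lookup₂ τ =
    fzero , fsuc j , fsuc k , s≤s z≤n , s≤s j<k , refl , eq₁ , eq₂
  ⊆⇒lookup₃ (_ ∷ʳ τ) with i , j , k , i<j , j<k , eq₀ , eq₁ , eq₂ ← ⊆⇒lookup₃ τ =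
    fsuc i , fsuc j , fsuc k , s≤s i<j , s≤s j<k , eq₀ , eq₁ , eq₂

  Contains132⇒Has132 : ∀ {π} → Contains132 π → Has132 π
  Contains132⇒Has132 {π} (i , j , k , i<j , j<k , a<c , c<b) = _ , _ , _ , lookup-⊆₃ π i j k i<j j<k , a<c , c<b

  Has132⇒Contains132 : ∀ {π} → Has132 π → Contains132 π
  Has132⇒Contains132 (a , b , c , τ , a<c , c<b) with ⊆⇒lookup₃ τ
  ... | i , j , k , i<j , j<k , refl , refl , refl = i , j , k , i<j , j<k , a<c , c<b

  No132-⊆ : ∀ {xs ys} → xs ⊆ ys → No132 ys → No132 xs
  No132-⊆ τ no132 (a , b , c , σ , a<c , c<b) = no132 (a , b , c , ⊆-trans σ τ , a<c , c<b)

  AllPairs-resp-⊆ : ∀ {R : ℕ → ℕ → Set} {xs ys} → xs ⊆ ys → AllPairs R ys → AllPairs R xs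
  AllPairs-resp-⊆ []         []         = []
  AllPairs-resp-⊆ (y ∷ʳ τ)   (_ ∷ Rys)  = AllPairs-resp-⊆ τ Rys
  AllPairs-resp-⊆ (refl ∷ τ) (Ry ∷ Rys) = All-resp-⊆ τ Ry ∷ AllPairs-resp-⊆ τ Rys

  increasing⇒No132 : ∀ {xs} → AllPairs _<_ xs → No132 xs
  increasing⇒No132 inc (a , b , c , τ , a<c , c<b) with AllPairs-resp-⊆ τ inc
  ... | _ ∷ (b<c ∷ _) ∷ _ = <-asym b<c c<b

  ⊆-map⁻ : ∀ (g : ℕ → ℕ) {zs} xs → zs ⊆ map g xs → ∃ λ zs′ → zs ≡ map g zs′ × zs′ ⊆ xs
  ⊆-map⁻ g []       []         = [] , refl , []
  ⊆-map⁻ g (x ∷ xs) (_ ∷ʳ τ)   with zs′ , eq , σ ← ⊆-map⁻ g xs τ = zs′ , eq , x ∷ʳ σ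
  ⊆-map⁻ g (x ∷ xs) (refl ∷ τ) with zs′ , refl , σ ← ⊆-map⁻ g xs τ = x ∷ zs′ , refl , refl ∷ σ

  No132-map⁺ : ∀ {g : ℕ → ℕ} → (∀ {a b} → g a < g b → a < b) → ∀ {xs} → No132 xs → No132 (map g xs)
  No132-map⁺ {g} g-reflects {xs} no132 (_ , _ , _ , τ , a<c , c<b)
    with a ∷ b ∷ c ∷ [] , refl , σ ← ⊆-map⁻ g xs τ = no132 (a , b , c , σ , g-reflects a<c , g-reflects c<b)

  No132-map⁻ : ∀ {g : ℕ → ℕ} → (∀ {a b} → a < b → g a < g b) → ∀ {xs} → No132 (map g xs) → No132 xs
  No132-map⁻ {g} g-mono no132 (a , b , c , τ , a<c , c<b) =
    no132 (g a , g b , g c , map⁺ g τ , g-mono a<c , g-mono c<b)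

  ⊆-insert : ∀ xs {y ys zs} → zs ⊆ xs ++ y ∷ ys →
             zs ⊆ xs ++ ys ⊎ ∃₂ λ z₁ z₂ → zs ≡ z₁ ++ y ∷ z₂ × z₁ ⊆ xs × z₂ ⊆ ys
  ⊆-insert []       (_ ∷ʳ τ)   = inj₁ τ
  ⊆-insert []       (refl ∷ τ) = inj₂ ([] , _ , refl , [] , τ)
  ⊆-insert (x ∷ xs) (_ ∷ʳ τ)   with ⊆-insert xs τ
  ... | inj₁ σ                          = inj₁ (x ∷ʳ σ)
  ... | inj₂ (z₁ , z₂ , eq , σ₁ , σ₂)   = inj₂ (z₁ , z₂ , eq , x ∷ʳ σ₁ , σ₂)
  ⊆-insert (x ∷ xs) (refl ∷ τ) with ⊆-insert xs τ
  ... | inj₁ σ                          = inj₁ (refl ∷ σ)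
  ... | inj₂ (z₁ , z₂ , refl , σ₁ , σ₂) = inj₂ (x ∷ z₁ , z₂ , refl , refl ∷ σ₁ , σ₂)

  Has132-insert : ∀ xs y ys → Has132 (xs ++ y ∷ ys) →
      Has132 (xs ++ ys)
    ⊎ (Σ ℕ λ b → Σ ℕ λ c → (b ∷ c ∷ []) ⊆ ys × y < c × c < b)
    ⊎ (Σ ℕ λ a → Σ ℕ λ c → a ∈ xs × c ∈ ys × a < c × c < y)
    ⊎ (Σ ℕ λ a → Σ ℕ λ b → (a ∷ b ∷ []) ⊆ xs × a < y × y < b)
  Has132-insert xs y ys (a , b , c , τ , a<c , c<b) with ⊆-insert xs τ
  ... | inj₁ σ                                           = inj₁ (a , b , c , σ , a<c , c<b)
  ... | inj₂ ([]                , _ , refl , _  , σ₂)    = inj₂ (inj₁ (b , c , σ₂ , a<c , c<b))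
  ... | inj₂ (_ ∷ []            , _ , refl , σ₁ , σ₂)    = inj₂ (inj₂ (inj₁ (a , c , to∈ σ₁ , to∈ σ₂ , a<c , c<b)))
  ... | inj₂ (_ ∷ _ ∷ []        , _ , refl , σ₁ , _)     = inj₂ (inj₂ (inj₂ (a , b , σ₁ , a<c , c<b)))
  ... | inj₂ (_ ∷ _ ∷ _ ∷ []     , _ , ()   , _  , _)
  ... | inj₂ (_ ∷ _ ∷ _ ∷ _ ∷ _  , _ , ()   , _  , _)

  No132-max∷ : ∀ {x xs} → No132 xs → (∀ {y} → y ∈ xs → y < x) → No132 (x ∷ xs)
  No132-max∷ no132 _ (a , b , c , _ ∷ʳ τ , a<c , c<b) = no132 (a , b , c , τ , a<c , c<b)
  No132-max∷ no132 max (_ , _ , _ , refl ∷ τ , a<c , _) = <-asym a<c (max (to∈ (∷ˡ⁻ τ)))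

  No132-∷ʳmax : ∀ {x xs} → No132 xs → (∀ {y} → y ∈ xs → y < x) → No132 (xs ++ [ x ])
  No132-∷ʳmax {x} {xs} no132 max has with Has132-insert xs x [] has
  ... | inj₁ has′                               = no132 (subst Has132 (List.++-identityʳ xs) has′)
  ... | inj₂ (inj₂ (inj₂ (_ , _ , τ , _ , x<b))) = <-asym x<b (max (to∈ (∷ˡ⁻ τ)))

  No132-∷ʳmin : ∀ {x xs} → No132 xs → (∀ {y} → y ∈ xs → x < y) → No132 (xs ++ [ x ])
  No132-∷ʳmin {x} {xs} no132 min has with Has132-insert xs x [] has
  ... | inj₁ has′                               = no132 (subst Has132 (List.++-identityʳ xs) has′)
  ... | inj₂ (inj₂ (inj₂ (_ , _ , τ , a<x , _))) = <-asym a<x (min (to∈ τ))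

  range-⊆ : ∀ {s} k {xs} → AllPairs _<_ xs → All (λ x → s ≤ x × x < s + k) xs → xs ⊆ range s k
  range-⊆         k       []           []                   = minimum _
  range-⊆ {s}     zero    (_ ∷ _)      ((s≤x , x<s) ∷ _)    =
    ⊥-elim (<-irrefl refl (≤-trans x<s (subst (_≤ _) (sym (+-identityʳ s)) s≤x)))
  range-⊆ {s}     (suc k) {x ∷ xs} (x<xs ∷ inc) ((s≤x , x<) ∷ bounds) with s ≟ x
  ... | yes refl = refl ∷ range-⊆ k inc (All.zipWith (λ (x<y , _ , y<) → x<y , raise y<) (x<xs , bounds))
    where raise : ∀ {y} → y < s + suc k → y < suc s + k
          raise {y} = subst (y <_) (+-suc s k)
  ... | no s≢x   = s ∷ʳ range-⊆ k (x<xs ∷ inc)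
                     ((s<x , raise x<) ∷ All.zipWith (λ (x<y , _ , y<) → <-trans s<x x<y , raise y<) (x<xs , bounds))
    where raise : ∀ {y} → y < s + suc k → y < suc s + k
          raise {y} = subst (y <_) (+-suc s k)
          s<x   = ≤∧≢⇒< s≤x s≢x

  No132-insert-min : ∀ {x xs z} → No132 (xs ++ [ z ]) → (∀ {y} → y ∈ xs → x ≤ y) → No132 (xs ++ x ∷ [ z ])
  No132-insert-min {x} {xs} {z} no132 min has with Has132-insert xs x [ z ] has
  ... | inj₁ has′                                       = no132 has′
  ... | inj₂ (inj₁ (_ , _ , _ ∷ʳ () , _))
  ... | inj₂ (inj₁ (_ , _ , refl ∷ () , _))
  ... | inj₂ (inj₂ (inj₁ (_ , _ , a∈ , _ , a<c , c<x))) = <⇒≱ (<-trans a<c c<x) (min a∈)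
  ... | inj₂ (inj₂ (inj₂ (_ , _ , τ , a<x , _)))       = <⇒≱ a<x (min (to∈ τ))

  map-app-∷ : ∀ x (π : List ℕ) a k → map (app (x ∷ π)) (range (2 + a) k) ≡ map (app π) (range (suc a) k)
  map-app-∷ x π a zero    = refl
  map-app-∷ x π a (suc k) = cong (app π (suc a) ∷_) (map-app-∷ x π (suc a) k)

  map-app-range : ∀ (π : List ℕ) → map (app π) (range 1 (length π)) ≡ π
  map-app-range []      = refl
  map-app-range (x ∷ π) = cong (x ∷_) (trans (map-app-∷ x π 0 (length π)) (map-app-range π))

  range-⊆₃ : ∀ {s k a b c} → s ≤ a → a < b → b < c → c < s + k → (a ∷ b ∷ c ∷ []) ⊆ range s k
  range-⊆₃ {k = k} s≤a a<b b<c c< = range-⊆ k ((a<b ∷ a<c ∷ []) ∷ (b<c ∷ []) ∷ [] ∷ [])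
    ((s≤a , <-trans a<c c<) ∷ (≤-trans s≤a (<⇒≤ a<b) , <-trans b<c c<) ∷ (≤-trans s≤a (<⇒≤ a<c) , c<) ∷ [])
    where a<c = <-trans a<b b<c

  app-Has132 : ∀ (π : List ℕ) {i j k} → 1 ≤ i → i < j → j < k → k ≤ length π →
               app π i < app π k → app π k < app π j → Has132 π
  app-Has132 π {i} {j} {k} 1≤i i<j j<k k≤ a<c c<b =
    _ , _ , _ , subst ((app π i ∷ app π j ∷ app π k ∷ []) ⊆_) (map-app-range π) (map⁺ (app π) (range-⊆₃ 1≤i i<j j<k (s≤s k≤))) , a<c , c<b

  around-⊆ : ∀ {a b c xs ys} → a ∈ xs → c ∈ ys → (a ∷ b ∷ c ∷ []) ⊆ xs ++ b ∷ ys
  around-⊆ a∈ c∈ = ++⁺ (from∈ a∈) (refl ∷ from∈ c∈)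

Perm : ℕ → List ℕ → Set
Perm n π = π ↭ oneToN n

module _ {n π} (P : Perm n π) where

  Perm⇒↭range : π ↭ range 1 n
  Perm⇒↭range = subst (π ↭_) (oneToN≡range n) P

  Perm-length : length π ≡ n
  Perm-length = trans (↭-length Perm⇒↭range) (length-range 1 n)

  Perm-unique : Unique π
  Perm-unique = Unique-resp-↭ (↭⇒↭ₛ (↭-sym Perm⇒↭range)) (range-unique 1 n)

  Perm-∈⁻ : ∀ {x} → x ∈ π → x ∈[1‥ n ]
  Perm-∈⁻ x∈ = ∈-range1⁻ (∈-resp-↭ Perm⇒↭range x∈)

  Perm-∈⁺ : ∀ {x} → x ∈[1‥ n ] → x ∈ π
  Perm-∈⁺ x∈ = ∈-resp-↭ (↭-sym Perm⇒↭range) (∈-range1⁺ x∈)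

Perm-head-max : ∀ {n rest y} → Perm n (n ∷ rest) → y ∈ rest → y < n
Perm-head-max P y∈ = ≤∧≢⇒< (proj₂ (Perm-∈⁻ P (there y∈))) (λ y≡n → All.lookup (AllPairs.head (Perm-unique P)) y∈ (sym y≡n))

range⇒Perm : ∀ {n π} → π ↭ range 1 n → Perm n π
range⇒Perm {n} {π} = subst (π ↭_) (sym (oneToN≡range n))

app-∈ : ∀ (π : List ℕ) {i} → i ∈[1‥ length π ] → app π i ∈ π
app-∈ (x ∷ π) {suc zero}    _       = here refl
app-∈ (x ∷ π) {suc (suc i)} (_ , u) = there (app-∈ π (s≤s z≤n , ≤-pred u))

∈⇒app : ∀ {π : List ℕ} {x} → x ∈ π → ∃ λ i → i ∈[1‥ length π ] × app π i ≡ x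
∈⇒app {y ∷ π} (here refl) = 1 , (≤-refl , s≤s z≤n) , refl
∈⇒app {y ∷ π} (there x∈) with suc i , (_ , u) , eq ← ∈⇒app x∈ = suc (suc i) , (s≤s z≤n , s≤s u) , eq

app-injective : ∀ {π : List ℕ} → Unique π → ∀ {i j} → i ∈[1‥ length π ] → j ∈[1‥ length π ] →
                app π i ≡ app π j → i ≡ j
app-injective {x ∷ π} _ {suc zero} {suc zero} _ _ _ = refl
app-injective {x ∷ π} u {suc zero} {suc (suc j)} _ (_ , u≤) eq =
  ⊥-elim (All.lookup (AllPairs.head u) (app-∈ π (s≤s z≤n , ≤-pred u≤)) eq)
app-injective {x ∷ π} u {suc (suc i)} {suc zero} (_ , u≤) _ eq =
  ⊥-elim (All.lookup (AllPairs.head u) (app-∈ π (s≤s z≤n , ≤-pred u≤)) (sym eq))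
app-injective {x ∷ π} u {suc (suc i)} {suc (suc j)} (_ , ui) (_ , uj) eq =
  cong suc (app-injective (AllPairs.tail u) (s≤s z≤n , ≤-pred ui) (s≤s z≤n , ≤-pred uj) eq)



module _ {g : ℕ → ℕ} {k} (increasing : ∀ {b c} → 1 ≤ b → b < c → c ≤ k → g b < g c) where

  increasing-+ : ∀ d {j} → 1 ≤ j → j + d ≤ k → g j + d ≤ g (j + d)
  increasing-+ zero    {j} _   _   = ≤-reflexive (trans (+-identityʳ (g j)) (cong g (sym (+-identityʳ j))))
  increasing-+ (suc d) {j} 1≤j j+d<k = begin
    g j + suc d       ≡⟨ +-suc (g j) d ⟩
    suc (g j + d)     ≤⟨ s≤s (increasing-+ d 1≤j (<⇒≤ j+d<k′)) ⟩
    suc (g (j + d))   ≤⟨ increasing (≤-trans 1≤j (m≤m+n j d)) (n<1+n (j + d)) j+d<k′ ⟩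
    g (suc (j + d))   ≡⟨ cong g (+-suc j d) ⟨
    g (j + suc d)     ∎
    where
    open ≤-Reasoning
    j+d<k′ : suc (j + d) ≤ k
    j+d<k′ = subst (_≤ k) (+-suc j d) j+d<k

  increasing-fixed : g 1 ≡ 1 → g k ≡ k → ∀ {j} → 1 ≤ j → j ≤ k → g j ≡ j
  increasing-fixed g1 gk {j} 1≤j j≤k = ≤-antisym below above
    where
    below : g j ≤ j
    below = +-cancelʳ-≤ (k ∸ j) (g j) j (begin
      g j + (k ∸ j)     ≤⟨ increasing-+ (k ∸ j) 1≤j (≤-reflexive (m+[n∸m]≡n j≤k)) ⟩
      g (j + (k ∸ j))   ≡⟨ cong g (m+[n∸m]≡n j≤k) ⟩
      g k               ≡⟨ gk ⟩
      k                 ≡⟨ m+[n∸m]≡n j≤k ⟨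
      j + (k ∸ j)       ∎)
      where open ≤-Reasoning
    above : j ≤ g j
    above = begin
      j                 ≡⟨ m+[n∸m]≡n 1≤j ⟨
      1 + (j ∸ 1)       ≡⟨ cong (_+ (j ∸ 1)) g1 ⟨
      g 1 + (j ∸ 1)     ≤⟨ increasing-+ (j ∸ 1) ≤-refl (≤-trans (≤-reflexive (m+[n∸m]≡n 1≤j)) j≤k) ⟩
      g (1 + (j ∸ 1))   ≡⟨ cong g (m+[n∸m]≡n 1≤j) ⟩
      g j               ∎
      where open ≤-Reasoning

iter : (ℕ → ℕ) → ℕ → ℕ → ℕ
iter g zero    x = x
iter g (suc k) x = g (iter g k x)

iter-+ : ∀ g i j x → iter g (i + j) x ≡ iter g i (iter g j x)
iter-+ g zero    j x = refl
iter-+ g (suc i) j x = cong g (iter-+ g i j x)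

iter-suc : ∀ g k x → iter g (suc k) x ≡ iter g k (g x)
iter-suc g k x = trans (cong (λ i → iter g i x) (+-comm 1 k)) (iter-+ g k 1 x)

orbit : (ℕ → ℕ) → ℕ → ℕ → List ℕ
orbit g x k = map (λ i → iter g i x) (range 0 k)

orbit-suc : ∀ g x k → orbit g x (suc k) ≡ x ∷ map (λ i → iter g (suc i) x) (range 0 k)
orbit-suc g x k = cong (x ∷_) (trans (cong (map _) (range-suc 0 k)) (sym (List.map-∘ (range 0 k))))

∈-orbit⁻ : ∀ {g x k y} → y ∈ orbit g x k → ∃ λ i → i < k × iter g i x ≡ y
∈-orbit⁻ y∈ with i , i∈ , refl ← ∈-map⁻ _ y∈ = i , proj₂ (∈-range⁻ i∈) , refl

∈-orbit⁺ : ∀ {g x k} i → i < k → iter g i x ∈ orbit g x k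
∈-orbit⁺ {g} {x} i i<k = ∈-map⁺ (λ i → iter g i x) (∈-range⁺ z≤n i<k)

Reaches : (ℕ → ℕ) → ℕ → ℕ → Set
Reaches g x y = ∃ λ i → iter g i x ≡ y

record Period (g : ℕ → ℕ) (x k : ℕ) : Set where
  field
    positive : 1 ≤ k
    returns  : iter g k x ≡ x
    minimal  : ∀ i → 1 ≤ i → i < k → iter g i x ≢ x
open Period public

iter-mod : ∀ {g x k} → Period g x k → ∀ i → ∃ λ r → r < k × iter g i x ≡ iter g r x
iter-mod {k = k} per zero = 0 , positive per , refl
iter-mod {g} {x} {k} per (suc i) with r , r<k , eq ← iter-mod per i | suc r <? k
... | yes r+1<k = suc r , r+1<k , cong g eq
... | no  r+1≮k = 0 , positive per ,
  trans (cong g eq) (trans (cong (λ j → iter g j x) (≤-antisym r<k (≮⇒≥ r+1≮k))) (returns per))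

iter∈orbit : ∀ {g x k} → Period g x k → ∀ i → iter g i x ∈ orbit g x k
iter∈orbit per i with r , r<k , eq ← iter-mod per i = subst (_∈ _) (sym eq) (∈-orbit⁺ r r<k)

Period-relabel : ∀ {g h φ x y k} → (∀ i → iter g i x ≡ φ (iter h i y)) → (∀ {a b} → φ a ≡ φ b → a ≡ b) →
                 Period h y k → Period g x k
Period-relabel {g} {h} {φ} {x} {y} {k} g≈h φ-inj per = record
  { positive = positive per
  ; returns  = trans (g≈h k) (trans (cong φ (returns per)) (sym (g≈h 0)))
  ; minimal  = λ i 1≤i i<k eq → minimal per i 1≤i i<k (φ-inj (trans (sym (g≈h i)) (trans eq (g≈h 0))))
  }

least : (Q : ℕ → Set) → (∀ i → Dec (Q i)) → ∀ bound → Q bound → ∃ λ k → k ≤ bound × Q k × (∀ i → i < k → ¬ Q i)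
least Q Q? zero    q = 0 , z≤n , q , λ _ ()
least Q Q? (suc b) q with Q? 0
... | yes q₀ = 0 , z≤n , q₀ , λ _ ()
... | no ¬q₀ with k , k≤b , qk , below ← least (λ i → Q (suc i)) (λ i → Q? (suc i)) b q =
  suc k , s≤s k≤b , qk , λ { zero _ → ¬q₀ ; (suc i) i<k → below i (≤-pred i<k) }

≡ᵇ-refl : ∀ m → (m ≡ᵇ m) ≡ true
≡ᵇ-refl zero    = refl
≡ᵇ-refl (suc m) = ≡ᵇ-refl m

≢⇒≡ᵇ-false : ∀ {x m} → x ≢ m → (x ≡ᵇ m) ≡ false
≢⇒≡ᵇ-false {x} {m} x≢m with x ≡ᵇ m in eq
... | false = refl
... | true  = ⊥-elim (x≢m (≡ᵇ⇒≡ x m (subst T (sym eq) tt)))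

-- The walk local to cycleFrom cannot be named outside Defs; unification
-- recovers it together with its defining equations.
record CycleWalk (π : List ℕ) (m : ℕ) : Set where
  field
    walk       : ℕ → ℕ → List ℕ
    walk-zero  : ∀ x → walk x 0 ≡ []
    walk-suc   : ∀ x fuel → walk x (suc fuel) ≡ (if x ≡ᵇ m then [] else x ∷ walk (app π x) fuel)
    cycleFrom≡ : cycleFrom π m ≡ m ∷ walk (app π m) (length π)

cycleWalk : ∀ π m → CycleWalk π m
cycleWalk π m = record { walk = go ; walk-zero = λ _ → refl ; walk-suc = λ _ _ → refl ; cycleFrom≡ = unfold }
  where
  go : ℕ → ℕ → List ℕ
  go = _
  unfold : cycleFrom π m ≡ m ∷ go (app π m) (length π)
  unfold with app π m | length π
  ... | _ | _ = refl

cycleFrom-orbit : ∀ {π m k} → Period (app π) m k → k ≤ suc (length π) → cycleFrom π m ≡ orbit (app π) m k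
cycleFrom-orbit {π} {m} {suc k} per k≤ =
  trans cycleFrom≡ (cong (m ∷_) (walk-orbit k 1 (length π) refl (s≤s z≤n) (≤-pred k≤)))
  where
  open CycleWalk (cycleWalk π m)
  walk-orbit : ∀ d j fuel → j + d ≡ suc k → 1 ≤ j → d ≤ fuel →
               walk (iter (app π) j m) fuel ≡ map (λ i → iter (app π) i m) (range j d)
  walk-orbit zero j zero j≡ _ _ = walk-zero (iter (app π) j m)
  walk-orbit zero j (suc fuel) j≡ _ _ = begin
    walk x (suc fuel)                           ≡⟨ walk-suc x fuel ⟩
    (if x ≡ᵇ m then [] else x ∷ walk (g x) fuel) ≡⟨ cong (λ y → if y ≡ᵇ m then [] else y ∷ walk (g y) fuel) back ⟩
    (if m ≡ᵇ m then [] else m ∷ walk (g m) fuel) ≡⟨ cong (λ b → if b then [] else m ∷ walk (g m) fuel) (≡ᵇ-refl m) ⟩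
    []                                          ∎
    where
    open ≡-Reasoning
    g = app π
    x = iter g j m
    back : x ≡ m
    back = trans (cong (λ i → iter g i m) (trans (sym (+-identityʳ j)) j≡)) (returns per)
  walk-orbit (suc d) j (suc fuel) j≡ 1≤j d<fuel = begin
    walk x (suc fuel)                            ≡⟨ walk-suc x fuel ⟩
    (if x ≡ᵇ m then [] else x ∷ walk (g x) fuel) ≡⟨ cong (λ b → if b then [] else x ∷ walk (g x) fuel) (≢⇒≡ᵇ-false x≢m) ⟩
    x ∷ walk (iter g (suc j) m) fuel             ≡⟨ cong (x ∷_) (walk-orbit d (suc j) fuel (trans (sym (+-suc j d)) j≡) (s≤s z≤n) (≤-pred d<fuel)) ⟩
    map (λ i → iter g i m) (range j (suc d))     ∎
    where
    open ≡-Reasoning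
    g = app π
    x = iter g j m
    x≢m : x ≢ m
    x≢m = minimal per j 1≤j (subst (j <_) j≡ (m<m+n j (s≤s z≤n)))

block : List ℕ → ℕ → List ℕ
block π m = if isCycleMax π m then cycleFrom π m else []

block-max : ∀ π m → (∀ {y} → y ∈ cycleFrom π m → y ≤ m) → block π m ≡ cycleFrom π m
block-max π m ≤m with isCycleMax π m in eq
... | true  = refl
... | false = ⊥-elim (subst T eq (all⁻ _ (All.tabulate (λ y∈ → ≤⇒≤ᵇ (≤m y∈)))))

block-not-max : ∀ π m {y} → y ∈ cycleFrom π m → m < y → block π m ≡ []
block-not-max π m {y} y∈ m<y with isCycleMax π m in eq
... | false = refl
... | true  = ⊥-elim (<⇒≱ m<y (≤ᵇ⇒≤ y m (All.lookup (all⁺ _ _ (subst T (sym eq) tt)) y∈)))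

∈-block⇒∈-cycleFrom : ∀ π m {y} → y ∈ block π m → y ∈ cycleFrom π m
∈-block⇒∈-cycleFrom π m y∈ with isCycleMax π m
... | true = y∈

block-cong : ∀ π σ m → cycleFrom π m ≡ cycleFrom σ m → block π m ≡ block σ m
block-cong π σ m = cong (λ c → if all (_≤ᵇ m) c then c else [])

block-relabel : ∀ {π σ m m′} (φ : ℕ → ℕ) → (∀ y → (φ y ≤ᵇ m) ≡ (y ≤ᵇ m′)) →
                cycleFrom π m ≡ map φ (cycleFrom σ m′) → block π m ≡ map φ (block σ m′)
block-relabel {π} {σ} {m} {m′} φ ≤ᵇ-φ cyc≡ = begin
  block π m                                                                 ≡⟨ cong (λ c → if all (_≤ᵇ m) c then c else []) cyc≡ ⟩
  (if all (_≤ᵇ m) (map φ c) then map φ c else [])                           ≡⟨ cong (λ b → if b then map φ c else []) all-φ ⟩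
  (if isCycleMax σ m′ then map φ c else [])                                 ≡⟨ if-map (isCycleMax σ m′) ⟩
  map φ (block σ m′)                                                        ∎
  where
  open ≡-Reasoning
  c = cycleFrom σ m′
  all-φ : all (_≤ᵇ m) (map φ c) ≡ all (_≤ᵇ m′) c
  all-φ = cong and (trans (sym (List.map-∘ c)) (List.map-cong ≤ᵇ-φ c))
  if-map : ∀ b → (if b then map φ c else []) ≡ map φ (if b then c else [])
  if-map true  = refl
  if-map false = refl

maximum : List ℕ → ℕ
maximum []       = 0
maximum (x ∷ xs) = x ⊔ maximum xs

≤-maximum : ∀ {x xs} → x ∈ xs → x ≤ maximum xs
≤-maximum {x} {y ∷ xs} (here refl) = m≤m⊔n x (maximum xs)
≤-maximum {x} {y ∷ xs} (there x∈) = ≤-trans (≤-maximum x∈) (m≤n⊔m y (maximum xs))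

maximum-∈ : ∀ x xs → maximum (x ∷ xs) ∈ x ∷ xs
maximum-∈ x []       = here (⊔-identityʳ x)
maximum-∈ x (y ∷ xs) with ⊔-sel x (maximum (y ∷ xs))
... | inj₁ eq = here eq
... | inj₂ eq = there (subst (_∈ y ∷ xs) (sym eq) (maximum-∈ y xs))

module Cycles {n π} (P : Perm n π) where

  f : ℕ → ℕ
  f = app π

  private
    ≤length : ∀ {i} → i ≤ n → i ≤ length π
    ≤length = subst (_ ≤_) (sym (Perm-length P))

    inRange : ∀ {i} → i ∈[1‥ n ] → i ∈[1‥ length π ]
    inRange (l , u) = l , ≤length u

  f-range : ∀ {x} → x ∈[1‥ n ] → f x ∈[1‥ n ]
  f-range x∈ = Perm-∈⁻ P (app-∈ π (inRange x∈))

  f-injective : ∀ {x y} → x ∈[1‥ n ] → y ∈[1‥ n ] → f x ≡ f y → x ≡ y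
  f-injective x∈ y∈ = app-injective (Perm-unique P) (inRange x∈) (inRange y∈)

  f-surjective : ∀ {y} → y ∈[1‥ n ] → ∃ λ x → x ∈[1‥ n ] × f x ≡ y
  f-surjective y∈ with x , (l , u) , eq ← ∈⇒app (Perm-∈⁺ P y∈) = x , (l , subst (_ ≤_) (Perm-length P) u) , eq

  iter-range : ∀ i {x} → x ∈[1‥ n ] → iter f i x ∈[1‥ n ]
  iter-range zero    x∈ = x∈
  iter-range (suc i) x∈ = f-range (iter-range i x∈)

  iter-injective : ∀ i {x y} → x ∈[1‥ n ] → y ∈[1‥ n ] → iter f i x ≡ iter f i y → x ≡ y
  iter-injective zero    _  _  eq = eq
  iter-injective (suc i) x∈ y∈ eq = iter-injective i x∈ y∈ (f-injective (iter-range i x∈) (iter-range i y∈) eq)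

  private
    pred<n : ∀ {y} → y ∈[1‥ n ] → pred y < n
    pred<n (s≤s z≤n , u) = u

    Returns : ℕ → ℕ → Set
    Returns x i = 1 ≤ i × iter f i x ≡ x

    returns? : ∀ x i → Dec (Returns x i)
    returns? x i = (1 ≤? i) ×-dec (iter f i x ≟ x)

  -- Pigeonhole on x, f x, …, fⁿ x.
  return-time : ∀ {x} → x ∈[1‥ n ] → ∃ λ d → d ≤ n × Returns x d
  return-time {x} x∈ with a , b , a<b , eq ← Fin.pigeonhole (n<1+n n) (λ a → fromℕ< (pred<n (iter-range (toℕ a) x∈))) =
    toℕ b ∸ toℕ a , ≤-trans (m∸n≤m (toℕ b) (toℕ a)) (≤-pred (Fin.toℕ<n b)) , m<n⇒0<n∸m a<b , back
    where
    unpred : ∀ a → suc (pred (iter f a x)) ≡ iter f a x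
    unpred a = suc-pred _ {{>-nonZero (proj₁ (iter-range a x∈))}}
    collision : iter f (toℕ a) x ≡ iter f (toℕ b) x
    collision = begin
      iter f (toℕ a) x                ≡⟨ unpred (toℕ a) ⟨
      suc (pred (iter f (toℕ a) x))   ≡⟨ cong suc (Fin.toℕ-fromℕ< _) ⟨
      suc (toℕ (fromℕ< _))            ≡⟨ cong (suc ∘ toℕ) eq ⟩
      suc (toℕ (fromℕ< _))            ≡⟨ cong suc (Fin.toℕ-fromℕ< _) ⟩
      suc (pred (iter f (toℕ b) x))   ≡⟨ unpred (toℕ b) ⟩
      iter f (toℕ b) x                ∎
      where open ≡-Reasoning
    back : iter f (toℕ b ∸ toℕ a) x ≡ x
    back = sym (iter-injective (toℕ a) x∈ (iter-range (toℕ b ∸ toℕ a) x∈)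
             (trans collision (trans (cong (λ i → iter f i x) (sym (m+[n∸m]≡n (<⇒≤ a<b)))) (iter-+ f (toℕ a) _ x))))

  period : ∀ {x} → x ∈[1‥ n ] → ∃ λ k → Period f x k × k ≤ n
  period {x} x∈ with d , d≤n , returns-at-d ← return-time x∈ with least (Returns x) (returns? x) d returns-at-d
  ... | k , k≤d , (1≤k , back) , below =
    k , record { positive = 1≤k ; returns = back ; minimal = λ i 1≤i i<k eq → below i i<k (1≤i , eq) } , ≤-trans k≤d d≤n

  infix 4 _↝_
  _↝_ : ℕ → ℕ → Set
  _↝_ = Reaches f

  ↝-refl : ∀ {x} → x ↝ x
  ↝-refl = 0 , refl

  ↝-step : ∀ {x} → x ↝ f x
  ↝-step = 1 , refl

  ↝-trans : ∀ {x y z} → x ↝ y → y ↝ z → x ↝ z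
  ↝-trans {x} (i , refl) (j , refl) = j + i , iter-+ f j i x

  ↝-range : ∀ {x y} → x ∈[1‥ n ] → x ↝ y → y ∈[1‥ n ]
  ↝-range x∈ (i , refl) = iter-range i x∈

  -- Going round the cycle the rest of the way.
  ↝-sym : ∀ {x y} → x ∈[1‥ n ] → x ↝ y → y ↝ x
  ↝-sym {x} x∈ (i , refl) with k , per , _ ← period x∈ with r , r<k , eq ← iter-mod per i =
    k ∸ r , (begin
      iter f (k ∸ r) (iter f i x)   ≡⟨ cong (iter f (k ∸ r)) eq ⟩
      iter f (k ∸ r) (iter f r x)   ≡⟨ iter-+ f (k ∸ r) r x ⟨
      iter f (k ∸ r + r) x          ≡⟨ cong (λ j → iter f j x) (m∸n+n≡m (<⇒≤ r<k)) ⟩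
      iter f k x                    ≡⟨ returns per ⟩
      x                             ∎)
    where open ≡-Reasoning

  ↝-pred : ∀ {a x} → a ∈[1‥ n ] → x ∈[1‥ n ] → a ↝ f x → a ↝ x
  ↝-pred a∈ x∈ a↝fx = ↝-sym x∈ (↝-trans ↝-step (↝-sym a∈ a↝fx))

  cycleFrom≡orbit : ∀ {x} → x ∈[1‥ n ] → ∃ λ k → Period f x k × k ≤ n × cycleFrom π x ≡ orbit f x k
  cycleFrom≡orbit x∈ with k , per , k≤n ← period x∈ =
    k , per , k≤n , cycleFrom-orbit {π} per (≤-trans k≤n (≤-trans (≤-reflexive (sym (Perm-length P))) (n≤1+n _)))

  ∈-cycleFrom⁻ : ∀ {x y} → x ∈[1‥ n ] → y ∈ cycleFrom π x → x ↝ y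
  ∈-cycleFrom⁻ x∈ y∈ with _ , _ , _ , eq ← cycleFrom≡orbit x∈ with i , _ , eq′ ← ∈-orbit⁻ (subst (_ ∈_) eq y∈) = i , eq′

  ∈-cycleFrom⁺ : ∀ {x y} → x ∈[1‥ n ] → x ↝ y → y ∈ cycleFrom π x
  ∈-cycleFrom⁺ x∈ (i , refl) with _ , per , _ , eq ← cycleFrom≡orbit x∈ = subst (_ ∈_) (sym eq) (iter∈orbit per i)

  ↝? : ∀ {x} y → x ∈[1‥ n ] → Dec (x ↝ y)
  ↝? {x} y x∈ with y Dec.∈? cycleFrom π x
  ... | yes y∈ = yes (∈-cycleFrom⁻ x∈ y∈)
  ... | no  y∉ = no (y∉ ∘ ∈-cycleFrom⁺ x∈)

  θ≡blocks : θ π ≡ concatMap (block π) (range 1 n)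
  θ≡blocks = cong (concatMap (block π)) (trans (cong oneToN (Perm-length P)) (oneToN≡range n))

  ∈-θ⁻ : ∀ {y} → y ∈ θ π → y ∈[1‥ n ]
  ∈-θ⁻ y∈ with x , x∈ , y∈block ← find (∈-concatMap⁻ (block π) (subst (_ ∈_) θ≡blocks y∈)) =
    ↝-range (∈-range1⁻ x∈) (∈-cycleFrom⁻ (∈-range1⁻ x∈) (∈-block⇒∈-cycleFrom π x y∈block))

  θ-top : ∀ {n′} → n ≡ suc n′ → θ π ≡ concatMap (block π) (range 1 n′) ++ cycleFrom π n
  θ-top {n′} refl = begin
    θ π                                                                  ≡⟨ θ≡blocks ⟩
    concatMap (block π) (range 1 (suc n′))                               ≡⟨ cong (concatMap (block π)) (range-∷ʳ 1 n′) ⟩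
    concatMap (block π) (range 1 n′ ++ [ n ])                            ≡⟨ List.concatMap-++ (block π) (range 1 n′) [ n ] ⟩
    concatMap (block π) (range 1 n′) ++ block π n ++ []                  ≡⟨ cong (concatMap (block π) (range 1 n′) ++_) (trans (List.++-identityʳ _) block-top) ⟩
    concatMap (block π) (range 1 n′) ++ cycleFrom π n                    ∎
    where
    open ≡-Reasoning
    n∈ : n ∈[1‥ n ]
    n∈ = s≤s z≤n , ≤-refl
    block-top : block π n ≡ cycleFrom π n
    block-top = block-max π n (proj₂ ∘ ↝-range n∈ ∘ ∈-cycleFrom⁻ n∈)

  ∈-prefix : ∀ {n′ y} → n ≡ suc n′ → y ∈[1‥ n ] → ¬ n ↝ y → y ∈ concatMap (block π) (range 1 n′)
  ∈-prefix {n′} {y} refl y∈ n↝̸y = ∈-concatMap⁺ (block π) (lose (∈-range1⁺ (proj₁ M∈ , M≤n′)) y∈block)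
    where
    M = maximum (cycleFrom π y)
    y↝M : y ↝ M
    y↝M = ∈-cycleFrom⁻ y∈ (maximum-∈ y _)
    M∈ : M ∈[1‥ n ]
    M∈ = ↝-range y∈ y↝M
    M≤n′ : M ≤ n′
    M≤n′ = ≤-pred (≤∧≢⇒< (proj₂ M∈) (λ M≡n → n↝̸y (↝-sym y∈ (subst (y ↝_) M≡n y↝M))))
    y∈block : y ∈ block π M
    y∈block = subst (y ∈_) (sym (block-max π M (λ z∈ → ≤-maximum (∈-cycleFrom⁺ y∈ (↝-trans y↝M (∈-cycleFrom⁻ M∈ z∈))))))
                (∈-cycleFrom⁺ M∈ (↝-sym y∈ y↝M))

  full-period : 1 ≤ n → (∀ {y} → y ∈[1‥ n ] → n ↝ y) → Period f n n
  full-period 1≤n n↝ with k , per , k≤n ← period (1≤n , ≤-refl) = subst (Period f n) (≤-antisym k≤n n≤k) per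
    where
    index : (y : Fin n) → ∃ λ r → r < k × iter f r n ≡ suc (toℕ y)
    index y with i , eq ← n↝ (s≤s z≤n , Fin.toℕ<n y) with r , r<k , eq′ ← iter-mod per i = r , r<k , trans (sym eq′) eq
    index-injective : ∀ {y z} → fromℕ< (proj₁ (proj₂ (index y))) ≡ fromℕ< (proj₁ (proj₂ (index z))) → y ≡ z
    index-injective {y} {z} eq = Fin.toℕ-injective (suc-injective (begin
      suc (toℕ y)                     ≡⟨ proj₂ (proj₂ (index y)) ⟨
      iter f (proj₁ (index y)) n      ≡⟨ cong (λ r → iter f r n) same ⟩
      iter f (proj₁ (index z)) n      ≡⟨ proj₂ (proj₂ (index z)) ⟩
      suc (toℕ z)                     ∎))
      where
      open ≡-Reasoning
      same : proj₁ (index y) ≡ proj₁ (index z)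
      same = trans (sym (Fin.toℕ-fromℕ< _)) (trans (cong toℕ eq) (Fin.toℕ-fromℕ< _))
    n≤k : n ≤ k
    n≤k = Fin.injective⇒≤ index-injective

app-∷ : ∀ x (xs : List ℕ) {i} → 1 ≤ i → app (x ∷ xs) (suc i) ≡ app xs i
app-∷ x xs (s≤s z≤n) = refl

app-++ˡ : ∀ (xs ys : List ℕ) {i} → i ∈[1‥ length xs ] → app (xs ++ ys) i ≡ app xs i
app-++ˡ (x ∷ xs) ys {suc zero}    _       = refl
app-++ˡ (x ∷ xs) ys {suc (suc i)} (_ , u) = app-++ˡ xs ys (s≤s z≤n , ≤-pred u)

app-++ʳ : ∀ (xs ys : List ℕ) {i} → 1 ≤ i → app (xs ++ ys) (i + length xs) ≡ app ys i
app-++ʳ []       ys {i} _   = cong (app ys) (+-identityʳ i)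
app-++ʳ (x ∷ xs) ys {i} 1≤i = begin
  app (x ∷ xs ++ ys) (i + suc (length xs))   ≡⟨ cong (app (x ∷ xs ++ ys)) (+-suc i (length xs)) ⟩
  app (x ∷ xs ++ ys) (suc (i + length xs))   ≡⟨ app-∷ x (xs ++ ys) (≤-trans 1≤i (m≤m+n i (length xs))) ⟩
  app (xs ++ ys) (i + length xs)             ≡⟨ app-++ʳ xs ys 1≤i ⟩
  app ys i                                   ∎
  where open ≡-Reasoning

app-∷ʳ : ∀ (xs : List ℕ) x → app (xs ++ [ x ]) (suc (length xs)) ≡ x
app-∷ʳ xs x = app-++ʳ xs [ x ] ≤-refl

app-map : ∀ (g : ℕ → ℕ) (xs : List ℕ) {i} → i ∈[1‥ length xs ] → app (map g xs) i ≡ g (app xs i)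
app-map g (x ∷ xs) {suc zero}    _       = refl
app-map g (x ∷ xs) {suc (suc i)} (_ , u) = app-map g xs (s≤s z≤n , ≤-pred u)

iter-conj : ∀ {g h : ℕ → ℕ} (φ : ℕ → ℕ) {x} K → (∀ i → i < K → g (φ (iter h i x)) ≡ φ (h (iter h i x))) →
            ∀ i → i ≤ K → iter g i (φ x) ≡ φ (iter h i x)
iter-conj         φ K comm zero    _   = refl
iter-conj {g} {h} φ K comm (suc i) i<K = trans (cong g (iter-conj φ K comm i (<⇒≤ i<K))) (comm i i<K)

cycleFrom-conj : ∀ {m σ} π (φ : ℕ → ℕ) → Perm m σ → (∀ {a b} → φ a ≡ φ b → a ≡ b) →
                 (∀ {x} → x ∈[1‥ m ] → app π (φ x) ≡ φ (app σ x)) → m ≤ length π →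
                 ∀ {x} → x ∈[1‥ m ] → cycleFrom π (φ x) ≡ map φ (cycleFrom σ x)
cycleFrom-conj {m} {σ} π φ Pσ φ-inj comm m≤ {x} x∈ with k , per , k≤m , cyc≡ ← Cycles.cycleFrom≡orbit Pσ x∈ = begin
  cycleFrom π (φ x)                                 ≡⟨ cycleFrom-orbit {π} (Period-relabel conj φ-inj per) (≤-trans k≤m (m≤n⇒m≤1+n m≤)) ⟩
  orbit (app π) (φ x) k                             ≡⟨ List.map-cong conj (range 0 k) ⟩
  map (φ ∘ (λ i → iter (app σ) i x)) (range 0 k)    ≡⟨ List.map-∘ (range 0 k) ⟩
  map φ (orbit (app σ) x k)                         ≡⟨ cong (map φ) cyc≡ ⟨
  map φ (cycleFrom σ x)                             ∎
  where
  open ≡-Reasoning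
  conj : ∀ i → iter (app π) i (φ x) ≡ φ (iter (app σ) i x)
  conj i = iter-conj φ i (λ j _ → comm (Cycles.iter-range Pσ j x∈)) i ≤-refl

cycleFrom-fixed : ∀ π {x} → app π x ≡ x → cycleFrom π x ≡ [ x ]
cycleFrom-fixed π fix = cycleFrom-orbit {π} {k = 1}
  (record { positive = ≤-refl ; returns = fix ; minimal = λ i 1≤i i<1 → ⊥-elim (<-irrefl refl (≤-trans i<1 1≤i)) })
  (s≤s z≤n)

cycleFrom-swap : ∀ π {x y} → 1 ≤ length π → x ≢ y → app π x ≡ y → app π y ≡ x → cycleFrom π x ≡ x ∷ y ∷ []
cycleFrom-swap π 1≤ x≢y xy yx = trans (cycleFrom-orbit {π} {k = 2} per (s≤s 1≤)) (cong (λ z → _ ∷ z ∷ []) xy)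
  where
  per : Period (app π) _ 2
  per = record
    { positive = s≤s z≤n
    ; returns  = trans (cong (app π) xy) yx
    ; minimal  = λ { (suc zero) _ _ eq → x≢y (trans (sym eq) xy) ; (suc (suc i)) _ (s≤s (s≤s ())) } }

concatMap-cong-local : ∀ {g h : ℕ → List ℕ} {xs} → (∀ {x} → x ∈ xs → g x ≡ h x) → concatMap g xs ≡ concatMap h xs
concatMap-cong-local g≗h = cong concat (List.map-cong-local (All.tabulate g≗h))

Perm-∷ʳ : ∀ {n σ} → Perm n σ → Perm (suc n) (σ ++ [ suc n ])
Perm-∷ʳ {n} {σ} P = range⇒Perm (subst (σ ++ [ suc n ] ↭_) (sym (range-∷ʳ 1 n)) (↭-++⁺ʳ [ suc n ] (Perm⇒↭range P)))

Perm-∷ʳ⁻ : ∀ {n σ} → Perm (suc n) (σ ++ [ suc n ]) → Perm n σ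
Perm-∷ʳ⁻ {n} {σ} P = range⇒Perm (subst₂ _↭_ (List.++-identityʳ σ) (List.++-identityʳ (range 1 n))
  (drop-mid σ (range 1 n) (subst (σ ++ [ suc n ] ↭_) (range-∷ʳ 1 n) (Perm⇒↭range P))))

θ-∷ʳ : ∀ {n σ} → Perm n σ → θ (σ ++ [ suc n ]) ≡ θ σ ++ [ suc n ]
θ-∷ʳ {n} {σ} Pσ = begin
  θ π                                                      ≡⟨ Cycles.θ-top (Perm-∷ʳ Pσ) refl ⟩
  concatMap (block π) (range 1 n) ++ cycleFrom π (suc n)   ≡⟨ cong₂ _++_ lower (cycleFrom-fixed π last) ⟩
  θ σ ++ [ suc n ]                                         ∎
  where
  open ≡-Reasoning
  π = σ ++ [ suc n ]
  length-σ : length σ ≡ n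
  length-σ = Perm-length Pσ
  agree : ∀ {x} → x ∈[1‥ n ] → app π x ≡ app σ x
  agree (l , u) = app-++ˡ σ [ suc n ] (l , subst (_ ≤_) (sym length-σ) u)
  last : app π (suc n) ≡ suc n
  last = subst (λ k → app π (suc k) ≡ suc n) length-σ (app-∷ʳ σ (suc n))
  same-block : ∀ {y} → y ∈ range 1 n → block π y ≡ block σ y
  same-block {y} y∈ = block-cong π σ y (trans (cycleFrom-conj π (λ z → z) Pσ (λ eq → eq) agree n≤ (∈-range1⁻ y∈)) (List.map-id _))
    where n≤ = ≤-trans (n≤1+n n) (≤-reflexive (sym (Perm-length (Perm-∷ʳ Pσ))))
  lower : concatMap (block π) (range 1 n) ≡ θ σ
  lower = trans (concatMap-cong-local same-block) (sym (Cycles.θ≡blocks Pσ))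

swap-ends : ∀ x (ys : List ℕ) y → x ∷ ys ++ [ y ] ↭ y ∷ ys ++ [ x ]
swap-ends x ys y = ↭-trans (prep x (shift y ys [])) (↭-trans (swap x y ↭-refl) (prep y (↭-sym (shift x ys []))))

range-ends : ∀ m → range 1 (2 + m) ≡ 1 ∷ range 2 m ++ [ 2 + m ]
range-ends m = cong (1 ∷_) (range-∷ʳ 2 m)

enclose : ℕ → List ℕ → List ℕ
enclose m B = 2 + m ∷ map suc B ++ [ 1 ]

Perm-enclose : ∀ {m B} → Perm m B → Perm (2 + m) (enclose m B)
Perm-enclose {m} {B} P = range⇒Perm (subst (enclose m B ↭_) (sym (range-ends m))
  (↭-trans (prep (2 + m) (↭-++⁺ʳ [ 1 ] (subst (map suc B ↭_) (sym (range-suc 1 m)) (↭-map⁺ suc (Perm⇒↭range P)))))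
           (swap-ends (2 + m) (range 2 m) 1)))

Perm-enclose⁻ : ∀ {m mid} → Perm (2 + m) (2 + m ∷ mid ++ [ 1 ]) → ∃ λ B → mid ≡ map suc B × Perm m B
Perm-enclose⁻ {m} {mid} P =
  let B , mid≡ , B↭ = ↭-map-inv suc (↭-sym mid↭) in B , mid≡ , range⇒Perm (↭-sym B↭)
  where
  ends-swapped : 1 ∷ mid ++ [ 2 + m ] ↭ 1 ∷ range 2 m ++ [ 2 + m ]
  ends-swapped = ↭-trans (↭-sym (swap-ends (2 + m) mid 1)) (subst (2 + m ∷ mid ++ [ 1 ] ↭_) (range-ends m) (Perm⇒↭range P))
  mid↭ : mid ↭ map suc (range 1 m)
  mid↭ = subst₂ _↭_ (List.++-identityʳ mid) (trans (List.++-identityʳ (range 2 m)) (range-suc 1 m))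
           (drop-mid mid (range 2 m) (drop-∷ ends-swapped))

θ-enclose : ∀ {m B} → Perm m B → θ (enclose m B) ≡ map suc (θ B) ++ 2 + m ∷ 1 ∷ []
θ-enclose {m} {B} PB = begin
  θ π                                                          ≡⟨ Cycles.θ-top (Perm-enclose PB) refl ⟩
  concatMap (block π) (range 1 (suc m)) ++ cycleFrom π (2 + m) ≡⟨ cong₂ _++_ lower (cycleFrom-swap π (s≤s z≤n) (λ ()) last refl) ⟩
  map suc (θ B) ++ 2 + m ∷ 1 ∷ []                              ∎
  where
  open ≡-Reasoning
  π = enclose m B
  length-sB : length (map suc B) ≡ m
  length-sB = trans (List.length-map suc B) (Perm-length PB)
  shifted : ∀ {x} → x ∈[1‥ m ] → app π (suc x) ≡ suc (app B x)
  shifted {x} (l , u) = begin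
    app π (suc x)                 ≡⟨ app-∷ (2 + m) _ l ⟩
    app (map suc B ++ [ 1 ]) x    ≡⟨ app-++ˡ (map suc B) [ 1 ] (l , subst (x ≤_) (sym length-sB) u) ⟩
    app (map suc B) x             ≡⟨ app-map suc B (l , subst (x ≤_) (sym (Perm-length PB)) u) ⟩
    suc (app B x)                 ∎
  last : app π (2 + m) ≡ 1
  last = subst (λ k → app (map suc B ++ [ 1 ]) (suc k) ≡ 1) length-sB (app-∷ʳ (map suc B) 1)
  m≤ : m ≤ length π
  m≤ = ≤-trans (≤-trans (n≤1+n m) (n≤1+n (suc m))) (≤-reflexive (sym (Perm-length (Perm-enclose PB))))
  shifted-block : ∀ {y} → y ∈ range 1 m → block π (suc y) ≡ map suc (block B y)
  shifted-block y∈ = block-relabel {π} {B} suc (λ { zero → refl ; (suc _) → refl })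
                       (cycleFrom-conj π suc PB suc-injective shifted m≤ (∈-range1⁻ y∈))
  block-1 : block π 1 ≡ []
  block-1 = block-not-max π 1 (subst (2 + m ∈_) (sym (cycleFrom-swap π (s≤s z≤n) (λ ()) refl last)) (there (here refl)))
              (s≤s (s≤s z≤n))
  lower : concatMap (block π) (range 1 (suc m)) ≡ map suc (θ B)
  lower = begin
    block π 1 ++ concatMap (block π) (range 2 m)       ≡⟨ cong₂ _++_ block-1 (cong (concatMap (block π)) (range-suc 1 m)) ⟩
    concatMap (block π) (map suc (range 1 m))          ≡⟨ List.concatMap-map (block π) suc (range 1 m) ⟩
    concatMap (block π ∘ suc) (range 1 m)              ≡⟨ concatMap-cong-local shifted-block ⟩
    concatMap (map suc ∘ block B) (range 1 m)          ≡⟨ List.map-concatMap suc (block B) (range 1 m) ⟨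
    map suc (concatMap (block B) (range 1 m))          ≡⟨ cong (map suc) (Cycles.θ≡blocks PB) ⟨
    map suc (θ B)                                      ∎

concatMap-[] : ∀ {g : ℕ → List ℕ} xs → (∀ {x} → x ∈ xs → g x ≡ []) → concatMap g xs ≡ []
concatMap-[] []       g≡[] = refl
concatMap-[] (x ∷ xs) g≡[] = cong₂ _++_ (g≡[] (here refl)) (concatMap-[] xs (g≡[] ∘ there))

-- When n's cycle is everything, every other block is empty and θ π is that cycle.
θ-cyclic : ∀ {n′ π} (P : Perm (suc n′) π) → (∀ {y} → y ∈[1‥ suc n′ ] → Reaches (app π) (suc n′) y) →
           θ π ≡ orbit (app π) (suc n′) (suc n′)
θ-cyclic {n′} {π} P n↝ = begin
  θ π                                                   ≡⟨ θ-top refl ⟩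
  concatMap (block π) (range 1 n′) ++ cycleFrom π n     ≡⟨ cong₂ _++_ (concatMap-[] (range 1 n′) lower-empty) top ⟩
  orbit (app π) n n                                     ∎
  where
  open ≡-Reasoning
  open Cycles P
  n = suc n′
  top : cycleFrom π n ≡ orbit (app π) n n
  top = cycleFrom-orbit {π} (full-period (s≤s z≤n) n↝) (≤-trans (≤-reflexive (sym (Perm-length P))) (n≤1+n _))
  lower-empty : ∀ {y} → y ∈ range 1 n′ → block π y ≡ []
  lower-empty y∈ with l , u ← ∈-range⁻ y∈ =
    block-not-max π _ (∈-cycleFrom⁺ y∈′ (↝-sym (s≤s z≤n , ≤-refl) (n↝ y∈′))) u
    where y∈′ = l , ≤-trans (≤-pred u) (n≤1+n n′)

-- θ π is the orbit of n when π is one n-cycle (θ-cyclic); stating the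
-- second avoidance condition on that orbit keeps it computable.
record GoodCycle (n : ℕ) (π : List ℕ) : Set where
  field
    perm        : Perm n π
    cyclic      : ∀ {y} → y ∈[1‥ n ] → Reaches (app π) n y
    no132       : No132 π
    no132-orbit : No132 (orbit (app π) n n)

rotation : ℕ → List ℕ
rotation zero    = []
rotation (suc n) = range 2 n ++ [ 1 ]

module GoodCycleProperties {n π} (C : GoodCycle (suc n) π) where

  open GoodCycle C
  open Cycles perm public

  N : ℕ
  N = suc n

  N∈ : N ∈[1‥ N ]
  N∈ = s≤s z≤n , ≤-refl

  1∈ : 1 ∈[1‥ N ]
  1∈ = ≤-refl , s≤s z≤n

  full : Period f N N
  full = full-period (s≤s z≤n) cyclic

  -- the letters of θ π = N π(N) π²(N) …
  w : ℕ → ℕ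
  w i = iter f i N

  w-range : ∀ i → w i ∈[1‥ N ]
  w-range i = iter-range i N∈

  private
    w-no-return : ∀ {i j} → i < j → j < N → w i ≢ w j
    w-no-return {i} {j} i<j j<N eq = minimal full (j ∸ i) (m<n⇒0<n∸m i<j) (≤-trans (s≤s (m∸n≤m j i)) j<N)
      (sym (iter-injective i N∈ (w-range (j ∸ i))
        (trans eq (trans (cong w (sym (m+[n∸m]≡n (<⇒≤ i<j)))) (iter-+ f i (j ∸ i) N)))))

  w-injective : ∀ {i j} → i < N → j < N → w i ≡ w j → i ≡ j
  w-injective {i} {j} i<N j<N eq with <-cmp i j
  ... | tri< i<j _ _ = ⊥-elim (w-no-return i<j j<N eq)
  ... | tri≈ _ i≡j _ = i≡j
  ... | tri> _ _ j<i = ⊥-elim (w-no-return j<i i<N (sym eq))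

  w≢N : ∀ {i} → 1 ≤ i → i < N → w i ≢ N
  w≢N = minimal full _

  w<N : ∀ {i} → 1 ≤ i → i < N → w i < N
  w<N {i} 1≤i i<N = ≤∧≢⇒< (proj₂ (w-range i)) (w≢N 1≤i i<N)

  w-surjective : ∀ {y} → y ∈[1‥ N ] → ∃ λ i → i < N × w i ≡ y
  w-surjective y∈ = let i , eq = cyclic y∈ ; r , r<N , eq′ = iter-mod full i in r , r<N , trans (sym eq′) eq

  w-last : ∀ {x} → x ∈[1‥ N ] → f x ≡ N → x ≡ w n
  w-last x∈ fx≡N = f-injective x∈ (w-range n) (trans fx≡N (sym (returns full)))

  no132-w : ∀ {a b c} → a < b → b < c → c < N → w a < w c → w c < w b → ⊥
  no132-w {a} {b} {c} a<b b<c c<N a<c c<b = no132-orbit (w a , w b , w c , map⁺ w (range-⊆₃ z≤n a<b b<c c<N) , a<c , c<b)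

  no132-π : ∀ {x y z} → 1 ≤ x → x < y → y < z → z ≤ N → f x < f z → f z < f y → ⊥
  no132-π 1≤x x<y y<z z≤N = λ a<c c<b → no132 (app-Has132 π 1≤x x<y y<z (subst (_ ≤_) (sym (Perm-length perm)) z≤N) a<c c<b)

  module FirstNotTop (1≤n : 1 ≤ n) (f1≢N : f 1 ≢ N) where

    p : ℕ
    p = w n

    fp≡N : f p ≡ N
    fp≡N = returns full

    p<N : p < N
    p<N = ≤∧≢⇒< (proj₂ (w-range n)) (λ p≡N → <-irrefl (sym (w-injective ≤-refl (s≤s z≤n) p≡N)) 1≤n)

    1<p : 1 < p
    1<p = ≤∧≢⇒< (proj₁ (w-range n)) (λ 1≡p → f1≢N (trans (cong f 1≡p) fp≡N))

    fN<f1 : f N < f 1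
    fN<f1 = ≤∧≢⇒< (≮⇒≥ (λ f1<fN → no132-π ≤-refl 1<p p<N ≤-refl f1<fN (subst (f N <_) (sym fp≡N) (w<N ≤-refl (s≤s 1≤n)))))
              (λ eq → <-irrefl (sym (f-injective N∈ 1∈ eq)) (s≤s 1≤n))

    f1≤p : f 1 ≤ p
    f1≤p = let a , a<N , wa≡1 = w-surjective 1∈ in from-position a a<N wa≡1 (suc a ≟ n)
      where
      from-position : ∀ a → a < N → w a ≡ 1 → Dec (suc a ≡ n) → f 1 ≤ p
      from-position a a<N wa≡1 (yes a+1≡n) = ≤-reflexive (trans (cong f (sym wa≡1)) (cong w a+1≡n))
      from-position a a<N wa≡1 (no a+1≢n)  = ≮⇒≥ λ p<f1 →
        no132-w (n<1+n a) a+1<n ≤-refl (subst (_< p) (sym wa≡1) 1<p) (subst (p <_) (cong f (sym wa≡1)) p<f1)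
        where
        a≢n : a ≢ n
        a≢n a≡n = <-irrefl (trans (sym wa≡1) (cong w a≡n)) 1<p
        a+1<n : suc a < n
        a+1<n = ≤∧≢⇒< (≤∧≢⇒< (≤-pred a<N) a≢n) a+1≢n

    p≡n : p ≡ n
    p≡n = ≤-antisym (≤-pred p<N) (≮⇒≥ p≮n)
      where
      from-position : ∀ b → b < N → w b ≡ n → Dec (b ≡ 1) → ¬ p < n
      from-position b b<N wb≡n (yes refl) p<n = <-irrefl wb≡n (<-trans (<-≤-trans fN<f1 f1≤p) p<n)
      from-position b b<N wb≡n (no b≢1)   p<n = no132-w 1<b b<n ≤-refl (<-≤-trans fN<f1 f1≤p) (subst (p <_) (sym wb≡n) p<n)
        where
        1<b : 1 < b
        1<b = ≤∧≢⇒< (≤∧≢⇒< z≤n (λ 0≡b → <-irrefl (trans (sym wb≡n) (cong w (sym 0≡b))) (n<1+n n))) (b≢1 ∘ sym)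
        b<n : b < n
        b<n = ≤∧≢⇒< (≤-pred b<N) (λ b≡n → <-irrefl (trans (cong w (sym b≡n)) wb≡n) p<n)
      p≮n : ¬ p < n
      p≮n = let b , b<N , wb≡n = w-surjective (1≤n , n≤1+n n) in from-position b b<N wb≡n (b ≟ 1)

    fN<f : ∀ {i} → 1 ≤ i → i < n → f N < f i
    fN<f {i} 1≤i i<n = ≤∧≢⇒< (≮⇒≥ λ fi<fN → no132-π 1≤i (subst (i <_) (sym p≡n) i<n) p<N ≤-refl fi<fN
                                              (subst (f N <_) (sym fp≡N) (w<N ≤-refl (s≤s 1≤n))))
                              (λ eq → <-irrefl (sym (f-injective N∈ (1≤i , ≤-trans (<⇒≤ i<n) (n≤1+n n)) eq)) (<-trans i<n (n<1+n n)))

    fN≡1 : f N ≡ 1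
    fN≡1 = let j , j∈ , fj≡1 = f-surjective 1∈ in from-preimage j j∈ fj≡1 (j ≟ N) (j ≟ n)
      where
      from-preimage : ∀ j → j ∈[1‥ N ] → f j ≡ 1 → Dec (j ≡ N) → Dec (j ≡ n) → f N ≡ 1
      from-preimage j _  fj≡1 (yes refl) _          = fj≡1
      from-preimage j _  fj≡1 (no _)     (yes refl) =
        ⊥-elim (<-irrefl (trans (sym fj≡1) (trans (cong f (sym p≡n)) fp≡N)) (s≤s 1≤n))
      from-preimage j j∈ fj≡1 (no j≢N)   (no j≢n)   =
        ⊥-elim (<-irrefl refl (<-≤-trans (subst (f N <_) fj≡1 (fN<f (proj₁ j∈) j<n)) (proj₁ (w-range 1))))
        where j<n = ≤∧≢⇒< (≤-pred (≤∧≢⇒< (proj₂ j∈) j≢N)) j≢n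

    1<w : ∀ {c} → 1 < c → c ≤ n → 1 < w c
    1<w {c} 1<c c≤n = ≤∧≢⇒< (proj₁ (w-range c)) (λ 1≡wc → <-irrefl (w-injective (s≤s 1≤n) (s≤s c≤n) (trans fN≡1 1≡wc)) 1<c)

    w-increasing : ∀ {b c} → 1 ≤ b → b < c → c ≤ n → w b < w c
    w-increasing {b} {c} 1≤b b<c c≤n = by-cases (b ≟ 1)
      where
      by-cases : Dec (b ≡ 1) → w b < w c
      by-cases (yes refl) = subst (_< w c) (sym fN≡1) (1<w b<c c≤n)
      by-cases (no b≢1)   = ≤∧≢⇒< (≮⇒≥ λ wc<wb → no132-w 1<b b<c (s≤s c≤n) (subst (_< w c) (sym fN≡1) (1<w (<-trans 1<b b<c) c≤n)) wc<wb)
                                  (λ eq → <-irrefl (w-injective (<-trans b<c (s≤s c≤n)) (s≤s c≤n) eq) b<c)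
        where 1<b = ≤∧≢⇒< 1≤b (b≢1 ∘ sym)

    w≡id : ∀ {j} → j ∈[1‥ n ] → w j ≡ j
    w≡id (1≤j , j≤n) = increasing-fixed w-increasing fN≡1 p≡n 1≤j j≤n

    f≡suc : ∀ {j} → j ∈[1‥ n ] → f j ≡ suc j
    f≡suc {j} (1≤j , j≤n) = by-cases (j ≟ n)
      where
      by-cases : Dec (j ≡ n) → f j ≡ suc j
      by-cases (yes refl) = trans (cong f (sym p≡n)) fp≡N
      by-cases (no j≢n)   = trans (cong f (sym (w≡id (1≤j , j≤n)))) (w≡id (s≤s z≤n , ≤∧≢⇒< j≤n j≢n))

    π≡rotation : π ≡ rotation N
    π≡rotation = begin
      π                                 ≡⟨ map-app-range π ⟨
      map f (range 1 (length π))        ≡⟨ cong (λ k → map f (range 1 k)) (Perm-length perm) ⟩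
      map f (range 1 (suc n))           ≡⟨ cong (map f) (range-∷ʳ 1 n) ⟩
      map f (range 1 n ++ [ N ])        ≡⟨ List.map-++ f (range 1 n) [ N ] ⟩
      map f (range 1 n) ++ [ f N ]      ≡⟨ cong₂ _++_ (List.map-cong-local (All.tabulate (f≡suc ∘ ∈-range1⁻))) (cong [_] fN≡1) ⟩
      map suc (range 1 n) ++ [ 1 ]      ≡⟨ cong (_++ [ 1 ]) (range-suc 1 n) ⟨
      rotation N                        ∎
      where open ≡-Reasoning

  rotation-forced : 1 ≤ n → f 1 ≢ N → π ≡ rotation N
  rotation-forced = FirstNotTop.π≡rotation

  top-first : 2 ≤ n → f 1 ≡ N → f N ≢ n → f n ≢ 1 → ⊥
  top-first 2≤n f1≡N fN≢n fn≢1 = let b , b<N , wb≡n = w-surjective (≤-trans (s≤s z≤n) 2≤n , n≤1+n n) in at b b<N wb≡n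
    where
    wn≡1 : w n ≡ 1
    wn≡1 = sym (w-last 1∈ f1≡N)
    1<N : 1 < N
    1<N = s≤s (≤-trans (s≤s z≤n) 2≤n)
    at : ∀ b → b < N → w b ≡ n → ⊥
    at zero          _   w0≡n = <-irrefl (sym w0≡n) ≤-refl
    at (suc zero)    _   w1≡n = fN≢n w1≡n
    at b@(suc (suc a)) b<N wb≡n =
      no132-π (proj₁ (w-range (suc b))) wb+1<wa (w<N (s≤s z≤n) a<N) ≤-refl wb+2<w1 (subst (w 1 <_) (sym wb≡n) w1<n)
      where
      b<n : b < n
      b<n = ≤∧≢⇒< (≤-pred b<N) λ b≡n → <-irrefl (trans (sym wn≡1) (trans (cong w (sym b≡n)) wb≡n)) 2≤n
      b+1<n : suc b < n
      b+1<n = ≤∧≢⇒< b<n λ b+1≡n → fn≢1 (trans (cong f (sym wb≡n)) (trans (cong w b+1≡n) wn≡1))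
      a<N : suc a < N
      a<N = <-trans (n<1+n (suc a)) b<N
      b+2<N : suc (suc b) < N
      b+2<N = s≤s b+1<n
      w<n : ∀ {i} → 1 ≤ i → i < N → i ≢ b → w i < n
      w<n {i} 1≤i i<N i≢b = ≤∧≢⇒< (≤-pred (w<N 1≤i i<N)) (λ wi≡n → i≢b (w-injective i<N b<N (trans wi≡n (sym wb≡n))))
      w1<n : w 1 < n
      w1<n = ≤∧≢⇒< (≤-pred (w<N ≤-refl 1<N)) fN≢n
      wb+2<w1 : w (suc (suc b)) < w 1
      wb+2<w1 = ≤∧≢⇒< (≮⇒≥ λ w1<wb+2 → no132-w (s≤s (s≤s z≤n)) (<-trans (n<1+n b) (n<1+n (suc b))) b+2<N w1<wb+2
                                           (subst (w (suc (suc b)) <_) (sym wb≡n) (w<n (s≤s z≤n) b+2<N (λ ()))))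
                        (λ eq → <-irrefl (sym (w-injective b+2<N 1<N eq)) (s≤s (s≤s z≤n)))
      wb+1<wa : w (suc b) < w (suc a)
      wb+1<wa = ≤∧≢⇒< (≮⇒≥ λ wa<wb+1 → no132-w (n<1+n (suc a)) (n<1+n b) (<-trans (n<1+n (suc b)) b+2<N) wa<wb+1
                                           (subst (w (suc b) <_) (sym wb≡n) (w<n (s≤s z≤n) (<-trans (n<1+n (suc b)) b+2<N) (λ ()))))
                        (λ eq → <-irrefl (sym (w-injective (<-trans (n<1+n (suc b)) b+2<N) a<N eq)) (≤-trans (n<1+n (suc a)) (n≤1+n b)))


-- On cycles: N is inserted between 1 and N - 1, so θ π = N ∷ θ π′.
extend₁ : List ℕ → List ℕ
extend₁ []        = []
extend₁ (x ∷ mid) = suc x ∷ mid ++ [ x ]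

module Extend₁ {n₂} (1≤n₂ : 1 ≤ n₂) (mid : List ℕ) (length-mid : length mid ≡ n₂) where

  n₁ = suc n₂
  N  = suc n₁
  π′ = n₁ ∷ mid
  π  = extend₁ π′

  π[N] : app π N ≡ n₁
  π[N] = subst (λ k → app (mid ++ [ n₁ ]) (suc k) ≡ n₁) length-mid (app-∷ʳ mid n₁)

  agree : ∀ {x} → 2 ≤ x → x ≤ n₁ → app π x ≡ app π′ x
  agree {suc zero}    (s≤s ()) _
  agree {suc (suc x)} _ x≤n₁ = app-++ˡ mid [ n₁ ] (s≤s z≤n , subst (suc x ≤_) (sym length-mid) (≤-pred x≤n₁))

  perm⁺ : Perm n₁ π′ → Perm N π
  perm⁺ P′ = range⇒Perm (↭-trans (swap-ends N mid n₁)
    (subst (π′ ++ [ N ] ↭_) (sym (range-∷ʳ 1 n₁)) (↭-++⁺ʳ [ N ] (Perm⇒↭range P′))))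

  perm⁻ : Perm N π → Perm n₁ π′
  perm⁻ P = range⇒Perm (subst₂ _↭_ (List.++-identityʳ π′) (List.++-identityʳ (range 1 n₁))
    (drop-mid π′ (range 1 n₁) (↭-trans (↭-sym (swap-ends N mid n₁)) (subst (π ↭_) (range-∷ʳ 1 n₁) (Perm⇒↭range P)))))

  no132⁺ : Perm n₁ π′ → No132 π′ → No132 π
  no132⁺ P′ no132′ = No132-max∷ (No132-∷ʳmax (No132-⊆ (n₁ ∷ʳ ⊆-refl) no132′) (Perm-head-max P′))
                                 (Perm-head-max (perm⁺ P′))

  no132⁻ : Perm n₁ π′ → No132 π → No132 π′
  no132⁻ P′ no132 = No132-max∷ (No132-⊆ (N ∷ʳ ++⁺ʳ [ n₁ ] ⊆-refl) no132) (Perm-head-max P′)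

  OrbitShift : Set
  OrbitShift = ∀ i → i ≤ n₂ → iter (app π) (suc i) N ≡ iter (app π′) i n₁

  orbit≡ : OrbitShift → orbit (app π) N N ≡ N ∷ orbit (app π′) n₁ n₁
  orbit≡ follow = trans (orbit-suc (app π) N n₁)
    (cong (N ∷_) (List.map-cong-local (All.tabulate λ i∈ → follow _ (≤-pred (proj₂ (∈-range⁻ i∈))))))

  orbitShift⁺ : GoodCycle n₁ π′ → OrbitShift
  orbitShift⁺ C′ i i≤n₂ = trans (iter-suc (app π) i N) (trans (cong (iter (app π) i) π[N])
    (iter-conj (λ z → z) n₂ (λ j j<n₂ → agree (2≤w j j<n₂) (proj₂ (w-range j))) i i≤n₂))
    where
    open GoodCycleProperties C′ using (w; w-range; w-injective; w-last; 1∈)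
    wn₂≡1 : w n₂ ≡ 1
    wn₂≡1 = sym (w-last 1∈ refl)
    2≤w : ∀ j → j < n₂ → 2 ≤ w j
    2≤w j j<n₂ = ≤∧≢⇒< (proj₁ (w-range j))
      (λ 1≡wj → <-irrefl (w-injective (≤-trans j<n₂ (n≤1+n n₂)) ≤-refl (trans (sym 1≡wj) (sym wn₂≡1))) j<n₂)

  orbitShift⁻ : GoodCycle N π → OrbitShift
  orbitShift⁻ C i i≤n₂ = sym (trans
    (iter-conj (λ z → z) n₂ (λ j j<n₂ → sym (subst (λ v → app π v ≡ app π′ v) (π-iter j) (agree (2≤w j j<n₂) (w≤n₁ j j<n₂)))) i i≤n₂)
    (sym (π-iter i)))
    where
    open GoodCycleProperties C using (w; w-range; w-injective; w-last; w<N; 1∈)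
    π-iter : ∀ j → w (suc j) ≡ iter (app π) j n₁
    π-iter j = trans (iter-suc (app π) j N) (cong (iter (app π) j) π[N])
    wn₁≡1 : w n₁ ≡ 1
    wn₁≡1 = sym (w-last 1∈ refl)
    2≤w : ∀ j → j < n₂ → 2 ≤ w (suc j)
    2≤w j j<n₂ = ≤∧≢⇒< (proj₁ (w-range (suc j)))
      (λ 1≡w → <-irrefl (w-injective (s≤s (≤-trans j<n₂ (n≤1+n n₂))) (n<1+n n₁) (trans (sym 1≡w) (sym wn₁≡1))) (s≤s j<n₂))
    w≤n₁ : ∀ j → j < n₂ → w (suc j) ≤ n₁
    w≤n₁ j j<n₂ = ≤-pred (w<N (s≤s z≤n) (s≤s (≤-trans j<n₂ (n≤1+n n₂))))

  good⁺ : GoodCycle n₁ π′ → GoodCycle N π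
  good⁺ C′ = record
    { perm        = perm⁺ P′
    ; cyclic      = cyclic⁺
    ; no132       = no132⁺ P′ (GoodCycle.no132 C′)
    ; no132-orbit = subst No132 (sym (orbit≡ follow))
                      (No132-max∷ (GoodCycle.no132-orbit C′) orbit<N)
    }
    where
    open GoodCycleProperties C′ using (w; w-range; w-surjective)
    P′ = GoodCycle.perm C′
    follow = orbitShift⁺ C′
    orbit<N : ∀ {y} → y ∈ orbit (app π′) n₁ n₁ → y < N
    orbit<N y∈ = let i , _ , eq = ∈-orbit⁻ y∈ in s≤s (subst (_≤ n₁) eq (proj₂ (w-range i)))
    via : ∀ {y} → (∃ λ i → i < n₁ × w i ≡ y) → Reaches (app π) N y
    via (i , i<n₁ , wi≡y) = suc i , trans (follow i (≤-pred i<n₁)) wi≡y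
    cyclic⁺ : ∀ {y} → y ∈[1‥ N ] → Reaches (app π) N y
    cyclic⁺ {y} (1≤y , y≤N) = by-cases (y ≟ N)
      where
      by-cases : Dec (y ≡ N) → Reaches (app π) N y
      by-cases (yes refl) = 0 , refl
      by-cases (no y≢N)   = via (w-surjective (1≤y , ≤-pred (≤∧≢⇒< y≤N y≢N)))

  good⁻ : GoodCycle N π → GoodCycle n₁ π′
  good⁻ C = record
    { perm        = P′
    ; cyclic      = cyclic⁻
    ; no132       = no132⁻ P′ (GoodCycle.no132 C)
    ; no132-orbit = No132-⊆ (subst (orbit (app π′) n₁ n₁ ⊆_) (sym (orbit≡ follow)) (N ∷ʳ ⊆-refl)) (GoodCycle.no132-orbit C)
    }
    where
    open GoodCycleProperties C using (w; w-surjective)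
    P′ = perm⁻ (GoodCycle.perm C)
    follow = orbitShift⁻ C
    via : ∀ {y} → y ≤ n₁ → (∃ λ i → i < N × w i ≡ y) → Reaches (app π′) n₁ y
    via y≤n₁ (zero  , _   , w0≡y) = ⊥-elim (<-irrefl (sym w0≡y) (s≤s y≤n₁))
    via y≤n₁ (suc i , i<N , wi≡y) = i , trans (sym (follow i (≤-pred (≤-pred i<N)))) wi≡y
    cyclic⁻ : ∀ {y} → y ∈[1‥ n₁ ] → Reaches (app π′) n₁ y
    cyclic⁻ (1≤y , y≤n₁) = via y≤n₁ (w-surjective (1≤y , ≤-trans y≤n₁ (n≤1+n n₁)))

insertOne : List ℕ → List ℕ
insertOne []          = [ 1 ]
insertOne (x ∷ [])    = 1 ∷ suc x ∷ []
insertOne (x ∷ y ∷ σ) = suc x ∷ insertOne (y ∷ σ)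

insertOne-∷ʳ : ∀ τ z → insertOne (τ ++ [ z ]) ≡ map suc τ ++ 1 ∷ suc z ∷ []
insertOne-∷ʳ []          z = refl
insertOne-∷ʳ (x ∷ [])    z = refl
insertOne-∷ʳ (x ∷ y ∷ τ) z = cong (suc x ∷_) (insertOne-∷ʳ (y ∷ τ) z)

-- On cycles: the cycle of σ, shifted up by one, is closed through 1 and N,
-- so θ π = N ∷ map suc (tail θ σ ++ [ N - 2 ]) ++ [ 1 ].
extend₂ : ℕ → List ℕ → List ℕ
extend₂ N σ = N ∷ insertOne σ

module Extend₂ {n₃} (τ : List ℕ) (length-τ : length τ ≡ n₃) (z : ℕ) where

  n₂ = suc n₃
  n₁ = suc n₂
  N  = suc n₁
  σ  = τ ++ [ z ]
  π  = N ∷ map suc τ ++ 1 ∷ suc z ∷ []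

  π≡extend₂ : extend₂ N σ ≡ π
  π≡extend₂ = cong (N ∷_) (insertOne-∷ʳ τ z)

  length-sτ : length (map suc τ) ≡ n₃
  length-sτ = trans (List.length-map suc τ) length-τ

  σ[n₂] : app σ n₂ ≡ z
  σ[n₂] = subst (λ k → app σ (suc k) ≡ z) length-τ (app-∷ʳ τ z)

  π-shift : ∀ {x} → x ∈[1‥ n₃ ] → app π (suc x) ≡ suc (app σ x)
  π-shift {x} (1≤x , x≤n₃) = begin
    app π (suc x)                          ≡⟨ app-∷ N _ 1≤x ⟩
    app (map suc τ ++ 1 ∷ suc z ∷ []) x    ≡⟨ app-++ˡ (map suc τ) _ (1≤x , subst (x ≤_) (sym length-sτ) x≤n₃) ⟩
    app (map suc τ) x                      ≡⟨ app-map suc τ (1≤x , subst (x ≤_) (sym length-τ) x≤n₃) ⟩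
    suc (app τ x)                          ≡⟨ cong suc (app-++ˡ τ [ z ] (1≤x , subst (x ≤_) (sym length-τ) x≤n₃)) ⟨
    suc (app σ x)                          ∎
    where open ≡-Reasoning

  π[n₁] : app π n₁ ≡ 1
  π[n₁] = subst (λ k → app π (suc (suc k)) ≡ 1) length-sτ (app-++ʳ (map suc τ) (1 ∷ suc z ∷ []) ≤-refl)

  π[N] : app π N ≡ suc z
  π[N] = subst (λ k → app π (suc (suc (suc k))) ≡ suc z) length-sτ (app-++ʳ (map suc τ) (1 ∷ suc z ∷ []) {2} (s≤s z≤n))

  map-suc-σ : map suc σ ≡ map suc τ ++ [ suc z ]
  map-suc-σ = List.map-++ suc τ [ z ]


  π↭ : π ↭ 1 ∷ map suc σ ++ [ N ]
  π↭ = ↭-trans (prep N (shift 1 (map suc τ) [ suc z ]))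
         (↭-trans (swap N 1 ↭-refl) (prep 1 (↭-trans (prep N (↭-reflexive (sym map-suc-σ))) (∷↭∷ʳ N (map suc σ)))))

  perm⁺ : Perm n₂ σ → Perm N π
  perm⁺ P = range⇒Perm (↭-trans π↭ (subst (1 ∷ map suc σ ++ [ N ] ↭_) (sym (range-ends n₂))
    (prep 1 (↭-++⁺ʳ [ N ] (subst (map suc σ ↭_) (sym (range-suc 1 n₂)) (↭-map⁺ suc (Perm⇒↭range P)))))))

  perm⁻ : Perm N π → Perm n₂ σ
  perm⁻ P = let σ′ , sσ≡ , σ′↭ = ↭-map-inv suc (↭-sym sσ↭) in
    range⇒Perm (subst (_↭ range 1 n₂) (sym (List.map-injective suc-injective sσ≡)) (↭-sym σ′↭))
    where
    sσ↭ : map suc σ ↭ map suc (range 1 n₂)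
    sσ↭ = subst₂ _↭_ (List.++-identityʳ _) (trans (List.++-identityʳ _) (range-suc 1 n₂))
            (drop-mid (map suc σ) (range 2 n₂)
              (drop-∷ (↭-trans (↭-sym π↭) (subst (π ↭_) (range-ends n₂) (Perm⇒↭range P)))))

  no132⁺ : Perm N π → No132 σ → No132 π
  no132⁺ P no132σ = No132-max∷ (No132-insert-min (subst No132 map-suc-σ (No132-map⁺ ≤-pred no132σ)) 1≤)
                                (Perm-head-max P)
    where
    1≤ : ∀ {y} → y ∈ map suc τ → 1 ≤ y
    1≤ y∈ with _ , _ , refl ← ∈-map⁻ suc y∈ = s≤s z≤n

  no132⁻ : No132 π → No132 σ
  no132⁻ no132 = No132-map⁻ s≤s (subst No132 (sym map-suc-σ)
                   (No132-⊆ (N ∷ʳ ++⁺ (⊆-refl {map suc τ}) (1 ∷ʳ ⊆-refl)) no132))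

  OrbitShift : Set
  OrbitShift = ∀ k → 1 ≤ k → k ≤ n₂ → iter (app π) k N ≡ suc (iter (app σ) k n₂)

  tailσ : List ℕ
  tailσ = map (λ i → iter (app σ) (suc i) n₂) (range 0 n₃)

  orbitσ≡ : orbit (app σ) n₂ n₂ ≡ n₂ ∷ tailσ
  orbitσ≡ = orbit-suc (app σ) n₂ n₃

  π-last : OrbitShift → iter (app σ) n₂ n₂ ≡ n₂ → iter (app π) n₁ N ≡ 1
  π-last follow σ-returns = trans (cong (app π) (trans (follow n₂ (s≤s z≤n) ≤-refl) (cong suc σ-returns))) π[n₁]

  orbit≡ : OrbitShift → iter (app σ) n₂ n₂ ≡ n₂ → orbit (app π) N N ≡ N ∷ map suc (tailσ ++ [ n₂ ]) ++ [ 1 ]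
  orbit≡ follow σ-returns = begin
    orbit (app π) N N                              ≡⟨ orbit-suc (app π) N n₁ ⟩
    N ∷ map g (range 0 n₁)                         ≡⟨ cong (λ r → N ∷ map g r) (range-∷ʳ 0 n₂) ⟩
    N ∷ map g (range 0 n₂ ++ [ n₂ ])               ≡⟨ cong (N ∷_) (List.map-++ g (range 0 n₂) [ n₂ ]) ⟩
    N ∷ map g (range 0 n₂) ++ [ g n₂ ]             ≡⟨ cong₂ (λ l x → N ∷ l ++ [ x ]) shifted (π-last follow σ-returns) ⟩
    N ∷ map suc (tailσ ++ [ n₂ ]) ++ [ 1 ]         ∎
    where
    open ≡-Reasoning
    g : ℕ → ℕ
    g i = iter (app π) (suc i) N
    h : ℕ → ℕ
    h i = iter (app σ) (suc i) n₂
    shifted : map g (range 0 n₂) ≡ map suc (tailσ ++ [ n₂ ])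
    shifted = begin
      map g (range 0 n₂)                 ≡⟨ List.map-cong-local (All.tabulate (λ i∈ → follow _ (s≤s z≤n) (proj₂ (∈-range⁻ i∈)))) ⟩
      map (suc ∘ h) (range 0 n₂)         ≡⟨ List.map-∘ (range 0 n₂) ⟩
      map suc (map h (range 0 n₂))       ≡⟨ cong (map suc) (trans (cong (map h) (range-∷ʳ 0 n₃)) (List.map-++ h (range 0 n₃) [ n₃ ])) ⟩
      map suc (tailσ ++ [ h n₃ ])        ≡⟨ cong (λ x → map suc (tailσ ++ [ x ])) σ-returns ⟩
      map suc (tailσ ++ [ n₂ ])          ∎

  no132-orbit⁺ : (∀ {y} → y ∈ tailσ → y ∈[1‥ n₂ ] × y ≢ n₂) → No132 (n₂ ∷ tailσ) →
                 No132 (N ∷ map suc (tailσ ++ [ n₂ ]) ++ [ 1 ])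
  no132-orbit⁺ tail-range no132 =
    No132-max∷ (No132-∷ʳmin (No132-map⁺ ≤-pred (No132-∷ʳmax (No132-⊆ (n₂ ∷ʳ ⊆-refl) no132) tail<n₂)) 1<) <N
    where
    tail<n₂ : ∀ {y} → y ∈ tailσ → y < n₂
    tail<n₂ y∈ = let (_ , y≤n₂) , y≢n₂ = tail-range y∈ in ≤∧≢⇒< y≤n₂ y≢n₂
    in-range : ∀ {y} → y ∈ tailσ ++ [ n₂ ] → y ∈[1‥ n₂ ]
    in-range y∈ with ∈-++⁻ tailσ y∈
    ... | inj₁ y∈tail      = proj₁ (tail-range y∈tail)
    ... | inj₂ (here refl) = s≤s z≤n , ≤-refl
    1< : ∀ {y} → y ∈ map suc (tailσ ++ [ n₂ ]) → 1 < y
    1< y∈ = let x , x∈ , y≡ = ∈-map⁻ suc y∈ in subst (1 <_) (sym y≡) (s≤s (proj₁ (in-range x∈)))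
    <N : ∀ {y} → y ∈ map suc (tailσ ++ [ n₂ ]) ++ [ 1 ] → y < N
    <N y∈ with ∈-++⁻ (map suc (tailσ ++ [ n₂ ])) y∈
    ... | inj₂ (here refl) = s≤s (s≤s z≤n)
    ... | inj₁ y∈′ = let x , x∈ , y≡ = ∈-map⁻ suc y∈′ in subst (_< N) (sym y≡) (s≤s (s≤s (proj₂ (in-range x∈))))

  no132-orbit⁻ : (∀ {y} → y ∈ tailσ → y < n₂) → No132 (N ∷ map suc (tailσ ++ [ n₂ ]) ++ [ 1 ]) → No132 (n₂ ∷ tailσ)
  no132-orbit⁻ tail<n₂ no132 =
    No132-max∷ (No132-⊆ (++⁺ʳ [ n₂ ] ⊆-refl) (No132-map⁻ s≤s (No132-⊆ (N ∷ʳ ++⁺ʳ [ 1 ] ⊆-refl) no132))) tail<n₂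

  orbitShift⁺ : GoodCycle n₂ σ → OrbitShift
  orbitShift⁺ C (suc i) _ i<n₂ = begin
    iter (app π) (suc i) N           ≡⟨ iter-suc (app π) i N ⟩
    iter (app π) i (app π N)         ≡⟨ cong (iter (app π) i) π[N] ⟩
    iter (app π) i (suc z)           ≡⟨ iter-conj suc n₃ shift-step i (≤-pred i<n₂) ⟩
    suc (iter (app σ) i z)           ≡⟨ cong (λ x → suc (iter (app σ) i x)) σ[n₂] ⟨
    suc (iter (app σ) i (app σ n₂))  ≡⟨ cong suc (iter-suc (app σ) i n₂) ⟨
    suc (iter (app σ) (suc i) n₂)    ∎
    where
    open ≡-Reasoning
    open GoodCycleProperties C using (w; w-range; w<N)
    w≡ : ∀ j → w (suc j) ≡ iter (app σ) j z
    w≡ j = trans (iter-suc (app σ) j n₂) (cong (iter (app σ) j) σ[n₂])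
    shift-step : ∀ j → j < n₃ → app π (suc (iter (app σ) j z)) ≡ suc (app σ (iter (app σ) j z))
    shift-step j j<n₃ = subst (λ x → app π (suc x) ≡ suc (app σ x)) (w≡ j)
                          (π-shift (proj₁ (w-range (suc j)) , ≤-pred (w<N (s≤s z≤n) (s≤s j<n₃))))

  good⁺ : GoodCycle n₂ σ → GoodCycle N π
  good⁺ C = record
    { perm        = P
    ; cyclic      = cyclic⁺
    ; no132       = no132⁺ P (GoodCycle.no132 C)
    ; no132-orbit = subst No132 (sym (orbit≡ follow (returns full)))
                      (no132-orbit⁺ tail-range (subst No132 orbitσ≡ (GoodCycle.no132-orbit C)))
    }
    where
    open GoodCycleProperties C using (w; w-range; w≢N; w-surjective; full)
    P = perm⁺ (GoodCycle.perm C)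
    follow = orbitShift⁺ C
    tail-range : ∀ {y} → y ∈ tailσ → y ∈[1‥ n₂ ] × y ≢ n₂
    tail-range y∈ = at (∈-map⁻ _ y∈)
      where
      at : ∀ {y} → (∃ λ i → i ∈ range 0 n₃ × y ≡ w (suc i)) → y ∈[1‥ n₂ ] × y ≢ n₂
      at (i , i∈ , refl) = w-range (suc i) , w≢N (s≤s z≤n) (s≤s (proj₂ (∈-range⁻ i∈)))
    via : ∀ {y} → (∃ λ i → i < n₂ × w i ≡ y) → Reaches (app π) N (suc y)
    via (zero  , _    , w0≡y) = n₂ , trans (follow n₂ (s≤s z≤n) ≤-refl) (cong suc (trans (returns full) w0≡y))
    via (suc k , k<n₂ , wk≡y) = suc k , trans (follow (suc k) (s≤s z≤n) (<⇒≤ k<n₂)) (cong suc wk≡y)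
    cyclic⁺ : ∀ {y} → y ∈[1‥ N ] → Reaches (app π) N y
    cyclic⁺ {suc zero}    _           = n₁ , π-last follow (returns full)
    cyclic⁺ {suc (suc y)} (_ , y<N)   = by-cases (suc (suc y) ≟ N)
      where
      by-cases : Dec (suc (suc y) ≡ N) → Reaches (app π) N (suc (suc y))
      by-cases (yes refl) = 0 , refl
      by-cases (no ≢N)    = via (w-surjective (s≤s z≤n , ≤-pred (≤-pred (≤∧≢⇒< y<N ≢N))))

  module Restrict (C : GoodCycle N π) where

    open GoodCycleProperties C using (w; w-range; w-injective; w-last; w<N; w-surjective; 1∈; f-injective)

    π-iter : ∀ j → w (suc j) ≡ iter (app π) j (suc z)
    π-iter j = trans (iter-suc (app π) j N) (cong (iter (app π) j) π[N])

    wn₁≡1 : w n₁ ≡ 1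
    wn₁≡1 = sym (w-last 1∈ refl)

    wn₂≡n₁ : w n₂ ≡ n₁
    wn₂≡n₁ = f-injective (w-range n₂) (s≤s z≤n , n≤1+n n₁) (trans wn₁≡1 (sym π[n₁]))

    w-middle : ∀ j → j < n₃ → 2 ≤ w (suc j) × w (suc j) ≤ n₂
    w-middle j j<n₃ =
      ≤∧≢⇒< (proj₁ (w-range (suc j))) (λ 1≡w → <-irrefl (w-injective j+1<N (n<1+n n₁) (trans (sym 1≡w) (sym wn₁≡1))) j+1<n₁) ,
      ≤-pred (≤∧≢⇒< (≤-pred (w<N (s≤s z≤n) j+1<N))
                     (λ w≡n₁ → <-irrefl (w-injective j+1<N (≤-trans (n<1+n n₂) (n≤1+n n₁)) (trans w≡n₁ (sym wn₂≡n₁))) (s≤s j<n₃)))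
      where
      j+1<n₁ = ≤-trans (s≤s j<n₃) (n≤1+n n₂)
      j+1<N  = <-trans j+1<n₁ (n<1+n n₁)

    unshift-step : ∀ j → j < n₃ → app σ (pred (iter (app π) j (suc z))) ≡ pred (app π (iter (app π) j (suc z)))
    unshift-step j j<n₃ = subst (λ x → app σ (pred x) ≡ pred (app π x)) (π-iter j) (unshift (w-middle j j<n₃))
      where
      unshift : ∀ {x} → 2 ≤ x × x ≤ n₂ → app σ (pred x) ≡ pred (app π x)
      unshift {suc zero}    (s≤s () , _)
      unshift {suc (suc x)} (_ , x≤n₂) = cong pred (sym (π-shift (s≤s z≤n , ≤-pred x≤n₂)))

    follow : OrbitShift
    follow (suc i) _ i<n₂ = begin
      iter (app π) (suc i) N              ≡⟨ π-iter i ⟩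
      iter (app π) i (suc z)              ≡⟨ suc-pred _ {{>-nonZero (subst (1 ≤_) (π-iter i) (proj₁ (w-range (suc i))))}} ⟨
      suc (pred (iter (app π) i (suc z))) ≡⟨ cong suc (iter-conj pred n₃ unshift-step i (≤-pred i<n₂)) ⟨
      suc (iter (app σ) i z)              ≡⟨ cong (λ x → suc (iter (app σ) i x)) σ[n₂] ⟨
      suc (iter (app σ) i (app σ n₂))     ≡⟨ cong suc (iter-suc (app σ) i n₂) ⟨
      suc (iter (app σ) (suc i) n₂)       ∎
      where open ≡-Reasoning

    σ-returns : iter (app σ) n₂ n₂ ≡ n₂
    σ-returns = suc-injective (trans (sym (follow n₂ (s≤s z≤n) ≤-refl)) wn₂≡n₁)

    tail<n₂ : ∀ {y} → y ∈ tailσ → y < n₂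
    tail<n₂ y∈ = at (∈-map⁻ _ y∈)
      where
      at : ∀ {y} → (∃ λ i → i ∈ range 0 n₃ × y ≡ iter (app σ) (suc i) n₂) → y < n₂
      at (i , i∈ , refl) = let i<n₃ = proj₂ (∈-range⁻ i∈) in
        subst (_≤ n₂) (follow (suc i) (s≤s z≤n) (s≤s (<⇒≤ i<n₃))) (proj₂ (w-middle i i<n₃))

    cyclic : ∀ {y} → y ∈[1‥ n₂ ] → Reaches (app σ) n₂ y
    cyclic {y} (1≤y , y≤n₂) = by-cases (y ≟ n₂)
      where
      via : (∃ λ k → k < N × w k ≡ suc y) → Reaches (app σ) n₂ y
      via (zero  , _   , w0≡) = ⊥-elim (<-irrefl (sym w0≡) (s≤s (s≤s y≤n₂)))
      via (suc k , k<N , wk≡) = by-k (suc k ≟ n₁)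
        where
        by-k : Dec (suc k ≡ n₁) → Reaches (app σ) n₂ y
        by-k (yes refl) = ⊥-elim (<-irrefl (sym (suc-injective (trans (sym wk≡) wn₁≡1))) 1≤y)
        by-k (no ≢n₁)   = suc k , suc-injective (trans (sym (follow (suc k) (s≤s z≤n) (≤-pred (≤∧≢⇒< (≤-pred k<N) ≢n₁)))) wk≡)
      by-cases : Dec (y ≡ n₂) → Reaches (app σ) n₂ y
      by-cases (yes refl) = 0 , refl
      by-cases (no _)     = via (w-surjective (s≤s z≤n , s≤s (≤-trans y≤n₂ (n≤1+n n₂))))

  good⁻ : GoodCycle N π → GoodCycle n₂ σ
  good⁻ C = record
    { perm        = perm⁻ (GoodCycle.perm C)
    ; cyclic      = cyclic
    ; no132       = no132⁻ (GoodCycle.no132 C)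
    ; no132-orbit = subst No132 (sym orbitσ≡)
                      (no132-orbit⁻ tail<n₂ (subst No132 (orbit≡ follow σ-returns) (GoodCycle.no132-orbit C)))
    }
    where open Restrict C

app-range : ∀ a k {i} → i < k → app (range a k) (suc i) ≡ a + i
app-range a (suc k) {zero}  _   = sym (+-identityʳ a)
app-range a (suc k) {suc i} i<k = trans (app-range (suc a) k (≤-pred i<k)) (sym (+-suc a i))

GoodCycle-rotation : ∀ n → GoodCycle (suc n) (rotation (suc n))
GoodCycle-rotation n = record
  { perm        = P
  ; cyclic      = cyclic
  ; no132       = No132-∷ʳmin (increasing⇒No132 (range-increasing 2 n)) (proj₁ ∘ ∈-range⁻)
  ; no132-orbit = subst No132 (sym orbit≡)
                    (No132-max∷ (increasing⇒No132 (range-increasing 1 n)) (proj₂ ∘ ∈-range⁻))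
  }
  where
  N = suc n
  π = rotation N
  P : Perm N π
  P = range⇒Perm (↭-sym (∷↭∷ʳ 1 (range 2 n)))
  length-range2 : length (range 2 n) ≡ n
  length-range2 = length-range 2 n
  π-suc : ∀ {j} → j ∈[1‥ n ] → app π j ≡ suc j
  π-suc {suc j} (1≤j , j≤n) =
    trans (app-++ˡ (range 2 n) [ 1 ] (1≤j , subst (suc j ≤_) (sym length-range2) j≤n)) (app-range 2 n j≤n)
  π-last : app π N ≡ 1
  π-last = subst (λ k → app π (suc k) ≡ 1) length-range2 (app-∷ʳ (range 2 n) 1)
  π-iter : ∀ {i} → i ∈[1‥ n ] → iter (app π) i N ≡ i
  π-iter {suc zero}    _           = π-last
  π-iter {suc (suc i)} (_ , i<n)   = trans (cong (app π) (π-iter (s≤s z≤n , <⇒≤ i<n))) (π-suc (s≤s z≤n , <⇒≤ i<n))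
  cyclic : ∀ {y} → y ∈[1‥ N ] → Reaches (app π) N y
  cyclic {y} (1≤y , y≤N) = by-cases (y ≟ N)
    where
    by-cases : Dec (y ≡ N) → Reaches (app π) N y
    by-cases (yes refl) = 0 , refl
    by-cases (no y≢N)   = y , π-iter (1≤y , ≤-pred (≤∧≢⇒< y≤N y≢N))
  orbit≡ : orbit (app π) N N ≡ N ∷ range 1 n
  orbit≡ = trans (orbit-suc (app π) N n) (cong (N ∷_)
    (trans (List.map-cong-local (All.tabulate (λ i∈ → π-iter (s≤s z≤n , proj₂ (∈-range⁻ i∈))))) (sym (range-suc 0 n))))

mutual
  goodCycles : ℕ → List (List ℕ)
  goodCycles zero    = []
  goodCycles (suc n) = rotation (suc n) ∷ topFirst (suc n)

  -- the good cycles π with π(1) = n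
  topFirst : ℕ → List (List ℕ)
  topFirst N@(suc n₁@(suc n₂@(suc _))) = map extend₁ (topFirst n₁) ++ map (extend₂ N) (goodCycles n₂)
  topFirst _                           = []

∈-topFirst⁻ : ∀ k {π} → π ∈ topFirst (3 + k) →
              (∃ λ π′ → π′ ∈ topFirst (2 + k) × π ≡ extend₁ π′) ⊎ (∃ λ σ → σ ∈ goodCycles (1 + k) × π ≡ extend₂ (3 + k) σ)
∈-topFirst⁻ k π∈ with ∈-++⁻ (map extend₁ (topFirst (2 + k))) π∈
... | inj₁ π∈₁ = inj₁ (∈-map⁻ extend₁ π∈₁)
... | inj₂ π∈₂ = inj₂ (∈-map⁻ (extend₂ (3 + k)) π∈₂)

topFirst-head : ∀ n {π} → π ∈ topFirst n → ∃ λ mid → π ≡ n ∷ mid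
topFirst-head (suc (suc (suc k))) π∈ = from (∈-topFirst⁻ k π∈) (topFirst-head (suc (suc k)))
  where
  from : ∀ {π} → (∃ λ π′ → π′ ∈ topFirst (2 + k) × π ≡ extend₁ π′) ⊎ (∃ λ σ → σ ∈ goodCycles (1 + k) × π ≡ extend₂ (3 + k) σ) →
         (∀ {π′} → π′ ∈ topFirst (2 + k) → ∃ λ mid → π′ ≡ 2 + k ∷ mid) → ∃ λ mid → π ≡ 3 + k ∷ mid
  from (inj₁ (π′ , π′∈ , refl)) head with mid , refl ← head π′∈ = mid ++ [ 2 + k ] , refl
  from (inj₂ (σ , _ , refl))     _    = insertOne σ , refl

∷ʳ-view : ∀ (xs : List ℕ) k → length xs ≡ suc k → ∃ λ ys → length ys ≡ k × xs ≡ ys ++ [ app xs (suc k) ]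
∷ʳ-view (x ∷ [])     zero    _   = [] , refl , refl
∷ʳ-view (x ∷ y ∷ xs) (suc k) len with ys , len′ , eq ← ∷ʳ-view (y ∷ xs) k (suc-injective len) =
  x ∷ ys , cong suc len′ , cong (x ∷_) eq

mutual
  goodCycles-sound : ∀ n {π} → π ∈ goodCycles n → GoodCycle n π
  goodCycles-sound (suc n) (here refl) = GoodCycle-rotation n
  goodCycles-sound (suc n) (there π∈)  = topFirst-sound (suc n) π∈

  topFirst-sound : ∀ n {π} → π ∈ topFirst n → GoodCycle n π
  topFirst-sound (suc (suc (suc k))) π∈ = from (∈-topFirst⁻ k π∈) (topFirst-sound (suc (suc k))) (goodCycles-sound (suc k))
    where
    from : ∀ {π} → (∃ λ π′ → π′ ∈ topFirst (2 + k) × π ≡ extend₁ π′) ⊎ (∃ λ σ → σ ∈ goodCycles (1 + k) × π ≡ extend₂ (3 + k) σ) →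
           (∀ {π′} → π′ ∈ topFirst (2 + k) → GoodCycle (2 + k) π′) → (∀ {σ} → σ ∈ goodCycles (1 + k) → GoodCycle (1 + k) σ) →
           GoodCycle (3 + k) π
    from (inj₁ (π′ , π′∈ , refl)) good₁ _ with mid , refl ← topFirst-head (2 + k) π′∈ =
      Extend₁.good⁺ (s≤s z≤n) mid (suc-injective (Perm-length (GoodCycle.perm (good₁ π′∈)))) (good₁ π′∈)
    from (inj₂ (σ , σ∈ , refl)) _ good₂ =
      let τ , length-τ , σ≡ = ∷ʳ-view σ k (Perm-length (GoodCycle.perm (good₂ σ∈))) in
      subst (GoodCycle (3 + k)) (trans (sym (Extend₂.π≡extend₂ τ length-τ _)) (cong (extend₂ (3 + k)) (sym σ≡)))
        (Extend₂.good⁺ τ length-τ _ (subst (GoodCycle (1 + k)) σ≡ (good₂ σ∈)))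

app-ends : ∀ (π : List ℕ) k → length π ≡ 2 + k → π ≡ app π 1 ∷ map (app π) (range 2 k) ++ [ app π (2 + k) ]
app-ends π k len = begin
  π                                                        ≡⟨ map-app-range π ⟨
  map (app π) (range 1 (length π))                         ≡⟨ cong (λ l → map (app π) (range 1 l)) len ⟩
  app π 1 ∷ map (app π) (range 2 (suc k))                  ≡⟨ cong (λ r → app π 1 ∷ map (app π) r) (range-∷ʳ 2 k) ⟩
  app π 1 ∷ map (app π) (range 2 k ++ [ 2 + k ])           ≡⟨ cong (app π 1 ∷_) (List.map-++ (app π) (range 2 k) [ 2 + k ]) ⟩
  app π 1 ∷ map (app π) (range 2 k) ++ [ app π (2 + k) ]   ∎
  where open ≡-Reasoning

module FirstIsTop {k π} (C : GoodCycle (3 + k) π) (π[1]≡N : app π 1 ≡ 3 + k) where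

  open GoodCycleProperties C using (f; f-range; top-first)
  open GoodCycle C using (perm)

  N  = 3 + k
  n₁ = 2 + k
  n₂ = 1 + k

  ends : π ≡ N ∷ map f (range 2 n₂) ++ [ f N ]
  ends = trans (app-ends π n₂ (Perm-length perm)) (cong (λ x → x ∷ map f (range 2 n₂) ++ [ f N ]) π[1]≡N)

  via-extend₂ : app π n₁ ≡ 1 → (∀ {σ} → GoodCycle n₂ σ → σ ∈ goodCycles n₂) → π ∈ topFirst N
  via-extend₂ π[n₁]≡1 complete₂ =
    subst (_∈ topFirst N) (trans (Extend₂.π≡extend₂ τ length-τ z) (sym π≡)) (∈-++⁺ʳ (map extend₁ (topFirst n₁)) (∈-map⁺ (extend₂ N) σ∈))
    where
    τ = map (pred ∘ f) (range 2 k)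
    z = pred (f N)
    length-τ : length τ ≡ k
    length-τ = trans (List.length-map _ (range 2 k)) (length-range 2 k)
    unpred : ∀ {x} → x ∈[1‥ N ] → suc (pred (f x)) ≡ f x
    unpred x∈ = suc-pred _ {{>-nonZero (proj₁ (f-range x∈))}}
    middle : map f (range 2 k) ≡ map suc τ
    middle = begin
      map f (range 2 k)                 ≡⟨ List.map-cong-local (All.tabulate λ x∈ → sym (unpred (in-range x∈))) ⟩
      map (suc ∘ pred ∘ f) (range 2 k)  ≡⟨ List.map-∘ (range 2 k) ⟩
      map suc τ                         ∎
      where
      open ≡-Reasoning
      in-range : ∀ {x} → x ∈ range 2 k → x ∈[1‥ N ]
      in-range x∈ = let l , u = ∈-range⁻ x∈ in ≤-trans (s≤s z≤n) l , ≤-trans (<⇒≤ u) (n≤1+n _)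
    π≡ : π ≡ Extend₂.π τ length-τ z
    π≡ = begin
      π                                                  ≡⟨ ends ⟩
      N ∷ map f (range 2 n₂) ++ [ f N ]                  ≡⟨ cong (λ r → N ∷ map f r ++ [ f N ]) (range-∷ʳ 2 k) ⟩
      N ∷ map f (range 2 k ++ [ n₁ ]) ++ [ f N ]         ≡⟨ cong (λ l → N ∷ l ++ [ f N ]) (List.map-++ f (range 2 k) [ n₁ ]) ⟩
      N ∷ (map f (range 2 k) ++ [ f n₁ ]) ++ [ f N ]     ≡⟨ cong (N ∷_) (List.++-assoc (map f (range 2 k)) [ f n₁ ] [ f N ]) ⟩
      N ∷ map f (range 2 k) ++ f n₁ ∷ f N ∷ []           ≡⟨ cong₂ (λ l x → N ∷ l ++ x ∷ f N ∷ []) middle π[n₁]≡1 ⟩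
      N ∷ map suc τ ++ 1 ∷ f N ∷ []                      ≡⟨ cong (λ x → N ∷ map suc τ ++ 1 ∷ x ∷ []) (unpred (s≤s z≤n , ≤-refl)) ⟨
      N ∷ map suc τ ++ 1 ∷ suc z ∷ []                    ∎
      where open ≡-Reasoning
    σ∈ : τ ++ [ z ] ∈ goodCycles n₂
    σ∈ = complete₂ (Extend₂.good⁻ τ length-τ z (subst (GoodCycle N) π≡ C))

  via-extend₁ : app π n₁ ≢ 1 → (∀ {π′} → GoodCycle n₁ π′ → π′ ∈ goodCycles n₁) → π ∈ topFirst N
  via-extend₁ π[n₁]≢1 complete₁ = from (complete₁ (Extend₁.good⁻ (s≤s z≤n) mid length-mid (subst (GoodCycle N) π≡ C)))
    where
    mid = map f (range 2 n₂)
    length-mid : length mid ≡ n₂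
    length-mid = trans (List.length-map f (range 2 n₂)) (length-range 2 n₂)
    π[N]≡n₁ : Dec (f N ≡ n₁) → f N ≡ n₁
    π[N]≡n₁ (yes eq) = eq
    π[N]≡n₁ (no neq) = ⊥-elim (top-first (s≤s (s≤s z≤n)) π[1]≡N neq π[n₁]≢1)
    π≡ : π ≡ extend₁ (n₁ ∷ mid)
    π≡ = trans ends (cong (λ x → N ∷ mid ++ [ x ]) (π[N]≡n₁ (f N ≟ n₁)))
    rotation-end : ∀ k {mid} → 2 + k ∷ mid ≡ rotation (2 + k) → app (extend₁ (2 + k ∷ mid)) (2 + k) ≡ 1
    rotation-end zero    refl = refl
    rotation-end (suc k) ()
    from : n₁ ∷ mid ∈ goodCycles n₁ → π ∈ topFirst N
    from (here rotation≡) = ⊥-elim (π[n₁]≢1 (trans (cong (λ l → app l n₁) π≡) (rotation-end k rotation≡)))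
    from (there π′∈)      = subst (_∈ topFirst N) (sym π≡) (∈-++⁺ˡ (∈-map⁺ extend₁ π′∈))

size-one : ∀ {π} → GoodCycle 1 π → π ≡ rotation 1
size-one C = ↭-singleton-inv (GoodCycle.perm C)

size-two : ∀ {π} → GoodCycle 2 π → π ≡ rotation 2
size-two {π} C = begin
  π                          ≡⟨ map-app-range π ⟨
  map f (range 1 (length π)) ≡⟨ cong (λ l → map f (range 1 l)) (Perm-length perm) ⟩
  f 1 ∷ f 2 ∷ []             ≡⟨ cong₂ (λ x y → x ∷ y ∷ []) f1≡2 f2≡1 ⟩
  2 ∷ 1 ∷ []                 ∎
  where
  open ≡-Reasoning
  open GoodCycle C using (perm)
  open GoodCycleProperties C using (f; f-range; f-injective; w≢N; 1∈; N∈)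
  f2≡1 : f 2 ≡ 1
  f2≡1 = ≤-antisym (≤-pred (≤∧≢⇒< (proj₂ (f-range N∈)) (w≢N ≤-refl ≤-refl))) (proj₁ (f-range N∈))
  f1≡2 : f 1 ≡ 2
  f1≡2 = ≤-antisym (proj₂ (f-range 1∈))
           (≤∧≢⇒< (proj₁ (f-range 1∈)) (λ 1≡f1 → <-irrefl (f-injective 1∈ N∈ (trans (sym 1≡f1) (sym f2≡1))) ≤-refl))

goodCycles-complete-step : ∀ {k π} → GoodCycle (3 + k) π → (∀ {π′} → GoodCycle (2 + k) π′ → π′ ∈ goodCycles (2 + k)) →
                (∀ {σ} → GoodCycle (1 + k) σ → σ ∈ goodCycles (1 + k)) → π ∈ goodCycles (3 + k)
goodCycles-complete-step {k} {π} C complete₁ complete₂ = by-start (app π 1 ≟ 3 + k)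
  where
  open GoodCycleProperties C using (rotation-forced)
  by-start : Dec (app π 1 ≡ 3 + k) → π ∈ goodCycles (3 + k)
  by-start (no π[1]≢N)  = here (rotation-forced (s≤s z≤n) π[1]≢N)
  by-start (yes π[1]≡N) = there (by-end (app π (2 + k) ≟ 1))
    where
    open FirstIsTop C π[1]≡N
    by-end : Dec (app π (2 + k) ≡ 1) → π ∈ topFirst (3 + k)
    by-end (yes π[n₁]≡1) = via-extend₂ π[n₁]≡1 complete₂
    by-end (no π[n₁]≢1)  = via-extend₁ π[n₁]≢1 complete₁

goodCycles-complete : ∀ n {π} → GoodCycle (suc n) π → π ∈ goodCycles (suc n)
goodCycles-complete zero          C = here (size-one C)
goodCycles-complete (suc zero)    C = here (size-two C)
goodCycles-complete (suc (suc k)) C = goodCycles-complete-step C (goodCycles-complete (suc k)) (goodCycles-complete k)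

length-goodCycles : ∀ n → length (goodCycles n) ≡ fib n
length-goodCycles zero                = refl
length-goodCycles (suc zero)          = refl
length-goodCycles (suc (suc zero))    = refl
length-goodCycles (suc (suc (suc k))) = begin
  suc (length (map extend₁ (topFirst (2 + k)) ++ map (extend₂ (3 + k)) (goodCycles (1 + k))))
    ≡⟨ cong suc (List.length-++ (map extend₁ (topFirst (2 + k)))) ⟩
  suc (length (map extend₁ (topFirst (2 + k))) + length (map (extend₂ (3 + k)) (goodCycles (1 + k))))
    ≡⟨ cong suc (cong₂ _+_ (List.length-map extend₁ (topFirst (2 + k))) (List.length-map (extend₂ (3 + k)) (goodCycles (1 + k)))) ⟩
  length (goodCycles (2 + k)) + length (goodCycles (1 + k))
    ≡⟨ cong₂ _+_ (length-goodCycles (suc (suc k))) (length-goodCycles (suc k)) ⟩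
  fib (2 + k) + fib (1 + k)
    ∎
  where open ≡-Reasoning

extend₁-injective : ∀ {π π′} → extend₁ π ≡ extend₁ π′ → π ≡ π′
extend₁-injective {[]}      {[]}        _  = refl
extend₁-injective {x ∷ mid} {x′ ∷ mid′} eq =
  let mid≡ , x≡ = List.∷ʳ-injective mid mid′ (List.∷-injectiveʳ eq) in cong₂ _∷_ x≡ mid≡

length-insertOne : ∀ σ → length (insertOne σ) ≡ suc (length σ)
length-insertOne []          = refl
length-insertOne (x ∷ [])    = refl
length-insertOne (x ∷ y ∷ σ) = cong suc (length-insertOne (y ∷ σ))

insertOne-injective : ∀ {σ σ′} → insertOne σ ≡ insertOne σ′ → σ ≡ σ′
insertOne-injective {σ} {σ′} eq =
  same-length σ σ′ (suc-injective (trans (sym (length-insertOne σ)) (trans (cong length eq) (length-insertOne σ′)))) eq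
  where
  same-length : ∀ σ σ′ → length σ ≡ length σ′ → insertOne σ ≡ insertOne σ′ → σ ≡ σ′
  same-length []          []            _   _    = refl
  same-length (x ∷ [])    (x′ ∷ [])     _   refl = refl
  same-length (x ∷ y ∷ σ) (x′ ∷ y′ ∷ σ′) len eq =
    cong₂ _∷_ (suc-injective (List.∷-injectiveˡ eq)) (same-length (y ∷ σ) (y′ ∷ σ′) (suc-injective len) (List.∷-injectiveʳ eq))

insertOne-1 : ∀ x σ → app (insertOne (x ∷ σ)) (suc (length σ)) ≡ 1
insertOne-1 x []      = refl
insertOne-1 x (y ∷ σ) = insertOne-1 y σ

top-first⇒¬last-1 : ∀ {n π} → GoodCycle n π → 3 ≤ n → app π 1 ≡ n → app π n ≢ 1
top-first⇒¬last-1 {suc n} {π} C 3≤n π[1]≡n π[n]≡1 = minimal full 2 (s≤s z≤n) 3≤n (trans (cong (app π) π[n]≡1) π[1]≡n)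
  where open GoodCycleProperties C using (full)

topFirst-disjoint : ∀ k → Disjoint (map extend₁ (topFirst (2 + k))) (map (extend₂ (3 + k)) (goodCycles (1 + k)))
topFirst-disjoint zero    (() , _)
topFirst-disjoint (suc k) (π∈₁ , π∈₂) = from₁ (∈-map⁻ extend₁ π∈₁) (from₂ (∈-map⁻ (extend₂ (4 + k)) π∈₂))
  where
  from₂ : ∀ {π} → (∃ λ σ → σ ∈ goodCycles (2 + k) × π ≡ extend₂ (4 + k) σ) → app π (3 + k) ≡ 1
  from₂ (σ , σ∈ , refl) = at σ (Perm-length (GoodCycle.perm (goodCycles-sound (2 + k) σ∈)))
    where
    at : ∀ σ → length σ ≡ 2 + k → app (extend₂ (4 + k) σ) (3 + k) ≡ 1
    at (x ∷ σ) len = subst (λ m → app (insertOne (x ∷ σ)) (suc m) ≡ 1) (suc-injective len) (insertOne-1 x σ)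
  from₁ : ∀ {π} → (∃ λ π′ → π′ ∈ topFirst (3 + k) × π ≡ extend₁ π′) → app π (3 + k) ≢ 1
  from₁ (π′ , π′∈ , refl) with topFirst-head (3 + k) π′∈
  ... | mid , refl = λ π[n₁]≡1 → top-first⇒¬last-1 C′ (s≤s (s≤s (s≤s z≤n))) refl
                       (trans (sym (Extend₁.agree (s≤s z≤n) mid length-mid (s≤s (s≤s z≤n)) ≤-refl)) π[n₁]≡1)
    where
    C′ = topFirst-sound (3 + k) π′∈
    length-mid : length mid ≡ 2 + k
    length-mid = suc-injective (Perm-length (GoodCycle.perm C′))

rotation∉topFirst : ∀ n {π} → π ∈ topFirst n → rotation n ≢ π
rotation∉topFirst (suc (suc (suc k))) π∈ with topFirst-head (3 + k) π∈
... | mid , refl = λ ()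

mutual
  goodCycles-unique : ∀ n → Unique (goodCycles n)
  goodCycles-unique zero    = AllPairs.[]
  goodCycles-unique (suc n) = All.tabulate (rotation∉topFirst (suc n)) AllPairs.∷ topFirst-unique (suc n)

  topFirst-unique : ∀ n → Unique (topFirst n)
  topFirst-unique (suc (suc (suc k))) =
    Unique.++⁺ (Unique.map⁺ extend₁-injective (topFirst-unique (suc (suc k))))
               (Unique.map⁺ (insertOne-injective ∘ List.∷-injectiveʳ) (goodCycles-unique (suc k)))
               (topFirst-disjoint k)
  topFirst-unique zero             = AllPairs.[]
  topFirst-unique (suc zero)       = AllPairs.[]
  topFirst-unique (suc (suc zero)) = AllPairs.[]

Good : ℕ → List ℕ → Set
Good n π = Perm n π × No132 π × No132 (θ π)

goodPerms : ℕ → List (List ℕ)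
goodPerms zero          = []
goodPerms (suc zero)    = [ [ 1 ] ]
goodPerms (suc (suc m)) = map (_++ [ 2 + m ]) (goodPerms (suc m)) ++ map (enclose m) (goodPerms m) ++ goodCycles (2 + m)

∈-map-suc⁻ : ∀ {m xs y} → (∀ {x} → x ∈ xs → x ∈[1‥ m ]) → y ∈ map suc xs → 1 < y × y ≤ suc m
∈-map-suc⁻ bounded y∈ = let x , x∈ , y≡ = ∈-map⁻ suc y∈ in subst (λ y → 1 < y × y ≤ _) (sym y≡) (s≤s (proj₁ (bounded x∈)) , s≤s (proj₂ (bounded x∈)))

Good-1 : Good 1 [ 1 ]
Good-1 = ↭-refl , no132 , no132
  where
  no132 : No132 [ 1 ]
  no132 (_ , _ , _ , _ ∷ʳ () , _)

Good-∷ʳ : ∀ {n σ} → Good n σ → Good (suc n) (σ ++ [ suc n ])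
Good-∷ʳ (P , no132 , no132-θ) =
  Perm-∷ʳ P , No132-∷ʳmax no132 (s≤s ∘ proj₂ ∘ Perm-∈⁻ P) ,
  subst No132 (sym (θ-∷ʳ P)) (No132-∷ʳmax no132-θ (s≤s ∘ proj₂ ∘ Cycles.∈-θ⁻ P))

Good-enclose : ∀ {m B} → Good m B → Good (2 + m) (enclose m B)
Good-enclose {m} {B} (P , no132 , no132-θ) =
  P′ ,
  No132-max∷ (No132-∷ʳmin (No132-map⁺ ≤-pred no132) (proj₁ ∘ ∈-map-suc⁻ (Perm-∈⁻ P))) (Perm-head-max P′) ,
  subst No132 (sym (trans (θ-enclose P) (sym (List.++-assoc (map suc (θ B)) [ 2 + m ] [ 1 ]))))
    (No132-∷ʳmin (No132-∷ʳmax (No132-map⁺ ≤-pred no132-θ) (s≤s ∘ proj₂ ∘ ∈-map-suc⁻ (Cycles.∈-θ⁻ P))) 1<)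
  where
  P′ = Perm-enclose P
  1< : ∀ {y} → y ∈ map suc (θ B) ++ [ 2 + m ] → 1 < y
  1< y∈ with ∈-++⁻ (map suc (θ B)) y∈
  ... | inj₁ y∈θ         = proj₁ (∈-map-suc⁻ (Cycles.∈-θ⁻ P) y∈θ)
  ... | inj₂ (here refl) = s≤s (s≤s z≤n)

GoodCycle⇒Good : ∀ {n π} → GoodCycle (suc n) π → Good (suc n) π
GoodCycle⇒Good C = perm , no132 , subst No132 (sym (θ-cyclic perm cyclic)) no132-orbit
  where open GoodCycle C

∈-goodPerms⁻ : ∀ m {π} → π ∈ goodPerms (2 + m) →
                 (∃ λ σ → σ ∈ goodPerms (1 + m) × π ≡ σ ++ [ 2 + m ])
               ⊎ (∃ λ B → B ∈ goodPerms m × π ≡ enclose m B)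
               ⊎ π ∈ goodCycles (2 + m)
∈-goodPerms⁻ m π∈ with ∈-++⁻ (map (_++ [ 2 + m ]) (goodPerms (1 + m))) π∈
... | inj₁ π∈₁ = inj₁ (∈-map⁻ _ π∈₁)
... | inj₂ π∈₂ with ∈-++⁻ (map (enclose m) (goodPerms m)) π∈₂
...   | inj₁ π∈₂′ = inj₂ (inj₁ (∈-map⁻ (enclose m) π∈₂′))
...   | inj₂ π∈₃  = inj₂ (inj₂ π∈₃)

goodPerms-sound : ∀ n {π} → π ∈ goodPerms n → Good n π
goodPerms-sound (suc zero)    (here refl) = Good-1
goodPerms-sound (suc (suc m)) π∈          = from (∈-goodPerms⁻ m π∈) (goodPerms-sound (suc m)) (goodPerms-sound m)
  where
  from : ∀ {π} → (∃ λ σ → σ ∈ goodPerms (1 + m) × π ≡ σ ++ [ 2 + m ]) ⊎ (∃ λ B → B ∈ goodPerms m × π ≡ enclose m B) ⊎ π ∈ goodCycles (2 + m) →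
         (∀ {σ} → σ ∈ goodPerms (1 + m) → Good (1 + m) σ) → (∀ {B} → B ∈ goodPerms m → Good m B) → Good (2 + m) π
  from (inj₁ (σ , σ∈ , refl))        good₁ _     = Good-∷ʳ (good₁ σ∈)
  from (inj₂ (inj₁ (B , B∈ , refl))) _     good₂ = Good-enclose (good₂ B∈)
  from (inj₂ (inj₂ π∈))              _     _     = GoodCycle⇒Good (goodCycles-sound (2 + m) π∈)

module Decompose {m π} (G : Good (2 + m) π) where

  n = 2 + m
  M = 1 + m

  P : Perm n π
  P = proj₁ G

  open Cycles P

  n∈ : n ∈[1‥ n ]
  n∈ = s≤s z≤n , ≤-refl

  M∈ : M ∈[1‥ n ]
  M∈ = s≤s z≤n , n≤1+n M

  -- The cycle of n comes last in θ π, so a z < o off that cycle, with o on it,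
  -- would give the pattern z n o in θ π.
  downward-closed : ∀ {o z} → n ↝ o → o ≢ n → 1 ≤ z → z < o → n ↝ z
  downward-closed {o} {z} n↝o o≢n 1≤z z<o = by-cases (↝? z n∈)
    where
    o<n : o < n
    o<n = ≤∧≢⇒< (proj₂ (↝-range n∈ n↝o)) o≢n
    o∈rest : ∀ {rest} → cycleFrom π n ≡ n ∷ rest → o ∈ rest
    o∈rest {rest} eq with subst (o ∈_) eq (∈-cycleFrom⁺ n∈ n↝o)
    ... | here o≡n = ⊥-elim (o≢n o≡n)
    ... | there o∈ = o∈
    z-n-o : ¬ n ↝ z → Has132 (θ π)
    z-n-o n↝̸z = z , n , o ,
      subst ((z ∷ n ∷ o ∷ []) ⊆_) (sym (θ-top refl))
        (around-⊆ (∈-prefix refl (1≤z , ≤-trans (<⇒≤ z<o) (<⇒≤ o<n)) n↝̸z) (o∈rest refl)) ,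
      z<o , o<n
    by-cases : Dec (n ↝ z) → n ↝ z
    by-cases (yes n↝z) = n↝z
    by-cases (no n↝̸z)  = ⊥-elim (proj₂ (proj₂ G) (z-n-o n↝̸z))

  cyclic : n ↝ M → ∀ {y} → y ∈[1‥ n ] → n ↝ y
  cyclic n↝M {y} (1≤y , y≤n) with y ≟ n | y ≟ M
  ... | yes refl | _        = ↝-refl
  ... | no _     | yes refl = n↝M
  ... | no y≢n   | no y≢M   = downward-closed n↝M (<⇒≢ (n<1+n M)) 1≤y (≤∧≢⇒< (≤-pred (≤∧≢⇒< y≤n y≢n)) y≢M)

  module NotCyclic (πn≢n : f n ≢ n) (n↝̸M : ¬ n ↝ M) where

    1∈ : 1 ∈[1‥ n ]
    1∈ = ≤-refl , s≤s z≤n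

    n↝1 : n ↝ 1
    n↝1 with f n ≟ 1
    ... | yes fn≡1 = subst (n ↝_) fn≡1 ↝-step
    ... | no  fn≢1 = downward-closed ↝-step πn≢n ≤-refl (≤∧≢⇒< (proj₁ (f-range n∈)) (fn≢1 ∘ sym))

    1≤m : 1 ≤ m
    1≤m = ≤∧≢⇒< z≤n (λ 0≡m → n↝̸M (subst (λ k → n ↝ suc k) 0≡m n↝1))

    n↝̸fM : ¬ n ↝ f M
    n↝̸fM n↝fM = n↝̸M (↝-pred n∈ M∈ n↝fM)

    <fM : ∀ {o} → n ↝ o → o ≢ n → o < f M
    <fM n↝o o≢n = ≤∧≢⇒< (≮⇒≥ λ fM<o → n↝̸fM (downward-closed n↝o o≢n (proj₁ (f-range M∈)) fM<o))
                        (λ o≡fM → n↝̸fM (subst (n ↝_) o≡fM n↝o))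

    fM<n : f M < n
    fM<n = ≤∧≢⇒< (proj₂ (f-range M∈)) (λ fM≡n → n↝̸fM (subst (n ↝_) (sym fM≡n) ↝-refl))

    no132 : No132 π
    no132 = proj₁ (proj₂ G)

    π-pattern : ∀ {i j k} → 1 ≤ i → i < j → j < k → k ≤ n → f i < f k → f k < f j → ⊥
    π-pattern 1≤i i<j j<k k≤n a<c c<b = no132 (app-Has132 π 1≤i i<j j<k (subst (_ ≤_) (sym (Perm-length P)) k≤n) a<c c<b)

    π1≡n : f 1 ≡ n
    π1≡n = let p , p∈ , fp≡n = f-surjective n∈ in from-preimage p p∈ fp≡n (p ≟ 1)
      where
      from-preimage : ∀ p → p ∈[1‥ n ] → f p ≡ n → Dec (p ≡ 1) → f 1 ≡ n
      from-preimage p _  fp≡n (yes refl) = fp≡n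
      from-preimage p p∈ fp≡n (no p≢1)   = ⊥-elim (π-pattern ≤-refl 1<p p<M (n≤1+n M) f1<fM (subst (f M <_) (sym fp≡n) fM<n))
        where
        n↝p : n ↝ p
        n↝p = ↝-pred n∈ p∈ (subst (n ↝_) (sym fp≡n) ↝-refl)
        1<p : 1 < p
        1<p = ≤∧≢⇒< (proj₁ p∈) (p≢1 ∘ sym)
        p<M : p < M
        p<M = ≤∧≢⇒< (≤-pred (≤∧≢⇒< (proj₂ p∈) λ p≡n → πn≢n (subst (λ x → f x ≡ n) p≡n fp≡n)))
                     (λ p≡M → n↝̸M (subst (n ↝_) p≡M n↝p))
        f1<fM : f 1 < f M
        f1<fM = <fM (↝-trans n↝1 ↝-step) (λ f1≡n → p≢1 (f-injective p∈ 1∈ (trans fp≡n (sym f1≡n))))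

    πn≡1 : f n ≡ 1
    πn≡1 = let i , i∈ , fi≡1 = f-surjective 1∈ in from-preimage i i∈ fi≡1 (i ≟ n)
      where
      from-preimage : ∀ i → i ∈[1‥ n ] → f i ≡ 1 → Dec (i ≡ n) → f n ≡ 1
      from-preimage i _  fi≡1 (yes refl) = fi≡1
      from-preimage i i∈ fi≡1 (no i≢n)   = ⊥-elim (π-pattern (proj₁ i∈) i<M (n<1+n M) ≤-refl 1<fn (<fM ↝-step πn≢n))
        where
        n↝i : n ↝ i
        n↝i = ↝-pred n∈ i∈ (subst (n ↝_) (sym fi≡1) n↝1)
        i<M : i < M
        i<M = ≤∧≢⇒< (≤-pred (≤∧≢⇒< (proj₂ i∈) i≢n)) (λ i≡M → n↝̸M (subst (n ↝_) i≡M n↝i))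
        1<fn : f i < f n
        1<fn = subst (_< f n) (sym fi≡1)
                 (≤∧≢⇒< (proj₁ (f-range n∈)) (λ 1≡fn → i≢n (f-injective i∈ n∈ (trans fi≡1 1≡fn))))

    enclosed : ∃ λ B → Perm m B × π ≡ enclose m B
    enclosed = let B , mid≡ , PB = Perm-enclose⁻ (subst (Perm n) π≡ P) in B , PB , trans π≡ (cong (λ l → n ∷ l ++ [ 1 ]) mid≡)
      where
      π≡ : π ≡ n ∷ map f (range 2 m) ++ [ 1 ]
      π≡ = trans (app-ends π m (Perm-length P)) (cong₂ (λ x y → x ∷ map f (range 2 m) ++ [ y ]) π1≡n πn≡1)

Good-∷ʳ⁻ : ∀ {n σ} → Good (suc n) (σ ++ [ suc n ]) → Good n σ
Good-∷ʳ⁻ (P , no132 , no132-θ) =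
  Pσ , No132-⊆ (++⁺ʳ [ _ ] ⊆-refl) no132 , No132-⊆ (++⁺ʳ [ _ ] ⊆-refl) (subst No132 (θ-∷ʳ Pσ) no132-θ)
  where Pσ = Perm-∷ʳ⁻ P

Good-enclose⁻ : ∀ {m B} → Perm m B → Good (2 + m) (enclose m B) → Good m B
Good-enclose⁻ {m} {B} PB (_ , no132 , no132-θ) =
  PB , No132-map⁻ s≤s (No132-⊆ (_ ∷ʳ ++⁺ʳ [ 1 ] ⊆-refl) no132) ,
  No132-map⁻ s≤s (No132-⊆ (++⁺ʳ (2 + m ∷ 1 ∷ []) ⊆-refl) (subst No132 (θ-enclose PB) no132-θ))

goodPerms-complete-step : ∀ {m π} → Good (2 + m) π → (∀ {σ} → Good (1 + m) σ → σ ∈ goodPerms (1 + m)) →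
                (1 ≤ m → ∀ {B} → Good m B → B ∈ goodPerms m) → π ∈ goodPerms (2 + m)
goodPerms-complete-step {m} {π} G complete₁ complete₀ = by-top (f n ≟ n)
  where
  open Decompose G
  open Cycles P using (f; ↝?)
  by-top : Dec (f n ≡ n) → π ∈ goodPerms n
  by-top (yes πn≡n) =
    let σ , _ , π≡ = ∷ʳ-view π M (Perm-length P)
        π≡σ++n = trans π≡ (cong (λ x → σ ++ [ x ]) πn≡n)
    in subst (_∈ goodPerms n) (sym π≡σ++n)
         (∈-++⁺ˡ (∈-map⁺ (_++ [ n ]) (complete₁ (Good-∷ʳ⁻ (subst (Good n) π≡σ++n G)))))
  by-top (no πn≢n) = by-M (↝? M n∈)
    where
    by-M : Dec (Reaches f n M) → π ∈ goodPerms n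
    by-M (yes n↝M) = ∈-++⁺ʳ (map (_++ [ n ]) (goodPerms M)) (∈-++⁺ʳ (map (enclose m) (goodPerms m))
      (goodCycles-complete M (record { perm = P ; cyclic = cyclic n↝M ; no132 = proj₁ (proj₂ G)
                                     ; no132-orbit = subst No132 (θ-cyclic P (cyclic n↝M)) (proj₂ (proj₂ G)) })))
    by-M (no n↝̸M) =
      let open NotCyclic πn≢n n↝̸M using (enclosed; 1≤m)
          B , PB , π≡ = enclosed
      in subst (_∈ goodPerms n) (sym π≡) (∈-++⁺ʳ (map (_++ [ n ]) (goodPerms M))
           (∈-++⁺ˡ (∈-map⁺ (enclose m) (complete₀ 1≤m (Good-enclose⁻ PB (subst (Good n) π≡ G))))))

goodPerms-complete : ∀ n {π} → 1 ≤ n → Good n π → π ∈ goodPerms n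
goodPerms-complete (suc zero)    _ (P , _) = here (↭-singleton-inv P)
goodPerms-complete (suc (suc m)) _ G       =
  goodPerms-complete-step G (goodPerms-complete (suc m) (s≤s z≤n)) (λ 1≤m → goodPerms-complete m 1≤m)

sum-upTo-suc : ∀ (g : ℕ → ℕ) n → sum (map g (upTo (suc n))) ≡ sum (map g (upTo n)) + g n
sum-upTo-suc g n = begin
  sum (map g (upTo (suc n)))          ≡⟨ cong (sum ∘ map g) (List.upTo-∷ʳ n) ⟨
  sum (map g (upTo n ++ [ n ]))       ≡⟨ cong sum (List.map-++ g (upTo n) [ n ]) ⟩
  sum (map g (upTo n) ++ [ g n ])     ≡⟨ sum-++ (map g (upTo n)) [ g n ] ⟩
  sum (map g (upTo n)) + (g n + 0)    ≡⟨ cong (sum (map g (upTo n)) +_) (+-identityʳ (g n)) ⟩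
  sum (map g (upTo n)) + g n          ∎
  where open ≡-Reasoning

sum-map-+ : ∀ (g h : ℕ → ℕ) xs → sum (map (λ x → g x + h x) xs) ≡ sum (map g xs) + sum (map h xs)
sum-map-+ g h []       = refl
sum-map-+ g h (x ∷ xs) = trans (cong (g x + h x +_) (sum-map-+ g h xs)) (interchange (g x) (h x) _ _)

convolution : ℕ → ℕ
convolution N = sum (map (λ k → fib (N ∸ k) * fib k) (upTo (suc N)))

-- Splitting F(N + 2 - k) = F(N + 1 - k) + F(N - k) for k ≤ N; the two top terms contribute F(N + 1).
convolution-rec : ∀ N → convolution (2 + N) ≡ convolution (1 + N) + convolution N + fib (1 + N)
convolution-rec N = begin
  convolution (2 + N)                                    ≡⟨ sum-upTo-suc term₂ (2 + N) ⟩
  sum (map term₂ (upTo (2 + N))) + term₂ (2 + N)         ≡⟨ cong (λ j → sum (map term₂ (upTo (2 + N))) + fib j * fib (2 + N)) (n∸n≡0 N) ⟩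
  sum (map term₂ (upTo (2 + N))) + 0                     ≡⟨ +-identityʳ _ ⟩
  sum (map term₂ (upTo (2 + N)))                         ≡⟨ sum-upTo-suc term₂ (1 + N) ⟩
  sum (map term₂ (upTo (1 + N))) + term₂ (1 + N)         ≡⟨ cong₂ _+_ split top ⟩
  sum (map term₁ (upTo (1 + N))) + convolution N + fib (1 + N)
                                                         ≡⟨ cong (λ s → s + convolution N + fib (1 + N)) lower ⟨
  convolution (1 + N) + convolution N + fib (1 + N)      ∎
  where
  open ≡-Reasoning
  term₂ term₁ term₀ : ℕ → ℕ
  term₂ k = fib (2 + N ∸ k) * fib k
  term₁ k = fib (1 + N ∸ k) * fib k
  term₀ k = fib (N ∸ k) * fib k
  top : term₂ (1 + N) ≡ fib (1 + N)
  top = trans (cong (λ j → fib j * fib (1 + N)) (m+n∸n≡m 1 N)) (+-identityʳ (fib (1 + N)))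
  step : ∀ {k} → k ∈ upTo (1 + N) → term₂ k ≡ term₁ k + term₀ k
  step {k} k∈ = let k≤N = ≤-pred (∈-upTo⁻ k∈) in begin
    fib (2 + N ∸ k) * fib k                        ≡⟨ cong (λ j → fib j * fib k) (+-∸-assoc 2 k≤N) ⟩
    fib (2 + (N ∸ k)) * fib k                      ≡⟨ *-distribʳ-+ (fib k) (fib (1 + (N ∸ k))) (fib (N ∸ k)) ⟩
    fib (1 + (N ∸ k)) * fib k + fib (N ∸ k) * fib k ≡⟨ cong (λ j → fib j * fib k + term₀ k) (+-∸-assoc 1 k≤N) ⟨
    term₁ k + term₀ k                              ∎
  split : sum (map term₂ (upTo (1 + N))) ≡ sum (map term₁ (upTo (1 + N))) + convolution N
  split = trans (cong sum (List.map-cong-local (All.tabulate step))) (sum-map-+ term₁ term₀ (upTo (1 + N)))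
  lower : convolution (1 + N) ≡ sum (map term₁ (upTo (1 + N)))
  lower = begin
    convolution (1 + N)                                ≡⟨ sum-upTo-suc term₁ (1 + N) ⟩
    sum (map term₁ (upTo (1 + N))) + term₁ (1 + N)     ≡⟨ cong (λ j → sum (map term₁ (upTo (1 + N))) + fib j * fib (1 + N)) (n∸n≡0 N) ⟩
    sum (map term₁ (upTo (1 + N))) + 0                 ≡⟨ +-identityʳ _ ⟩
    sum (map term₁ (upTo (1 + N)))                     ∎

fibConv-rec : ∀ m → fibConv (2 + m) ≡ fibConv (1 + m) + (fibConv m + fib (2 + m))
fibConv-rec m = trans (convolution-rec (1 + m)) (+-assoc (convolution (2 + m)) (convolution (1 + m)) (fib (2 + m)))

goodPerms-nonempty⇒1≤ : ∀ {m π} → π ∈ goodPerms m → 1 ≤ m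
goodPerms-nonempty⇒1≤ {suc _} _ = s≤s z≤n

last-fixed : ∀ m {π} → π ∈ map (_++ [ 2 + m ]) (goodPerms (1 + m)) → app π (2 + m) ≡ 2 + m
last-fixed m π∈ with σ , σ∈ , refl ← ∈-map⁻ (_++ [ 2 + m ]) π∈ =
  subst (λ k → app (σ ++ [ 2 + m ]) (suc k) ≡ 2 + m) (Perm-length (proj₁ (goodPerms-sound (1 + m) σ∈))) (app-∷ʳ σ (2 + m))

enclose-ends : ∀ m {π} → π ∈ map (enclose m) (goodPerms m) → 1 ≤ m × app π 1 ≡ 2 + m × app π (2 + m) ≡ 1
enclose-ends m π∈ with B , B∈ , refl ← ∈-map⁻ (enclose m) π∈ =
  goodPerms-nonempty⇒1≤ B∈ , refl ,
  subst (λ k → app (map suc B ++ [ 1 ]) (suc k) ≡ 1)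
        (trans (List.length-map suc B) (Perm-length (proj₁ (goodPerms-sound m B∈)))) (app-∷ʳ (map suc B) 1)

enclose∩cycles : ∀ m → Disjoint (map (enclose m) (goodPerms m)) (goodCycles (2 + m))
enclose∩cycles m (π∈₁ , π∈₂) = let 1≤m , π1≡n , πn≡1 = enclose-ends m π∈₁ in
  top-first⇒¬last-1 (goodCycles-sound (2 + m) π∈₂) (s≤s (s≤s 1≤m)) π1≡n πn≡1

fixed∩rest : ∀ m → Disjoint (map (_++ [ 2 + m ]) (goodPerms (1 + m))) (map (enclose m) (goodPerms m) ++ goodCycles (2 + m))
fixed∩rest m {π} (π∈₁ , π∈₂) with ∈-++⁻ (map (enclose m) (goodPerms m)) π∈₂
... | inj₁ π∈enclose = 1≢2+m (trans (sym (proj₂ (proj₂ (enclose-ends m π∈enclose)))) (last-fixed m π∈₁))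
  where
  1≢2+m : 1 ≢ 2 + m
  1≢2+m ()
... | inj₂ π∈cycles  = GoodCycleProperties.w≢N (goodCycles-sound (2 + m) π∈cycles) ≤-refl (s≤s (s≤s z≤n)) (last-fixed m π∈₁)

goodPerms-unique : ∀ n → Unique (goodPerms n)
goodPerms-unique zero          = AllPairs.[]
goodPerms-unique (suc zero)    = All.[] AllPairs.∷ AllPairs.[]
goodPerms-unique (suc (suc m)) =
  Unique.++⁺ (Unique.map⁺ (List.∷ʳ-injectiveˡ _ _) (goodPerms-unique (suc m)))
    (Unique.++⁺ (Unique.map⁺ enclose-injective (goodPerms-unique m)) (goodCycles-unique (2 + m)) (enclose∩cycles m))
    (fixed∩rest m)
  where
  enclose-injective : ∀ {B B′} → enclose m B ≡ enclose m B′ → B ≡ B′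
  enclose-injective eq = List.map-injective suc-injective (List.∷ʳ-injectiveˡ _ _ (List.∷-injectiveʳ eq))

length-goodPerms : ∀ n → length (goodPerms n) ≡ fibConv n
length-goodPerms zero          = refl
length-goodPerms (suc zero)    = refl
length-goodPerms (suc (suc m)) = begin
  length (map (_++ [ 2 + m ]) (goodPerms (1 + m)) ++ map (enclose m) (goodPerms m) ++ goodCycles (2 + m))
    ≡⟨ List.length-++ (map (_++ [ 2 + m ]) (goodPerms (1 + m))) ⟩
  length (map (_++ [ 2 + m ]) (goodPerms (1 + m))) + length (map (enclose m) (goodPerms m) ++ goodCycles (2 + m))
    ≡⟨ cong₂ _+_ (List.length-map _ (goodPerms (1 + m))) (List.length-++ (map (enclose m) (goodPerms m))) ⟩
  length (goodPerms (1 + m)) + (length (map (enclose m) (goodPerms m)) + length (goodCycles (2 + m)))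
    ≡⟨ cong₂ (λ a b → length (goodPerms (1 + m)) + (a + b)) (List.length-map (enclose m) (goodPerms m)) (length-goodCycles (2 + m)) ⟩
  length (goodPerms (1 + m)) + (length (goodPerms m) + fib (2 + m))
    ≡⟨ cong₂ (λ a b → a + (b + fib (2 + m))) (length-goodPerms (suc m)) (length-goodPerms m) ⟩
  fibConv (1 + m) + (fibConv m + fib (2 + m))
    ≡⟨ fibConv-rec m ⟨
  fibConv (2 + m)
    ∎
  where open ≡-Reasoning

theorem3p2 : (n : ℕ) → n ≥ 1 →
    Σ (List (List ℕ)) (λ L →
    Unique L ×
    ((π : List ℕ) → (π ∈ L) ⇔ ((π ↭ oneToN n) × Avoids132 π × Avoids132 (θ π))) ×
    (length L ≡ fibConv n))
theorem3p2 n n≥1 = goodPerms n , goodPerms-unique n , (λ π → mk⇔ sound complete) , length-goodPerms n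
  where
  sound : ∀ {π} → π ∈ goodPerms n → (π ↭ oneToN n) × Avoids132 π × Avoids132 (θ π)
  sound π∈ with P , no132 , no132-θ ← goodPerms-sound n π∈ =
    P , no132 ∘ Contains132⇒Has132 , no132-θ ∘ Contains132⇒Has132
  complete : ∀ {π} → (π ↭ oneToN n) × Avoids132 π × Avoids132 (θ π) → π ∈ goodPerms n
  complete (P , avoids , avoids-θ) = goodPerms-complete n n≥1 (P , avoids ∘ Has132⇒Contains132 , avoids-θ ∘ Has132⇒Contains132)
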